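{- Let $t\ge 0$ be an integer. For $n\ge 1$, let $\overline{p}_t(n)$ denote the number of overpartitions of $n$ in which the difference between the largest part and the smallest part is at most $t$. Then, as formal power series in $q$, $$\sum_{n\ge 1}\overline{p}_t(n) q^n=2(-1)^t \left(\sum_{n\ge 1}d(n)q^n + \sum_{n=1}^t \frac{(-1)^n}{1-q^n}\left(\frac{(-q;q)_n}{(q;q)_n}-1\right)\right),$$ where $d(n)$ is the number of positive divisors of $n$.
   Context: An overpartition of a positive integer $n$ is a partition of $n$ (a non-increasing sequence of positive integers summing to $n$) in which the first occurrence of each distinct part may be overlined. Notation: $(a;q)_n=\prod_{k=0}^{n-1}(1-aq^k)$; an empty sum is $0$. -}

module Defs where

open import Data.Bool using (Bool; true; false; _∧_; if_then_else_; T?)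
open import Data.Nat as ℕ using (ℕ; zero; suc; _∸_; _⊔_; _⊓_)
open import Data.Nat.Divisibility using (_∣?_)
open import Data.Product using (_×_; _,_; proj₁; proj₂)
open import Data.List using (List; []; _∷_; map; concatMap; upTo; length; filter)
open import Data.Integer as ℤ using (ℤ; +_; -_; _^_)
open import Relation.Nullary.Decidable using (does; ⌊_⌋)
open import Function using (_∘_)

-- An overpartition is represented as a list of (part , overlined?) pairs,
-- listed in non-increasing order of parts; only the first occurrence of a
-- part may be overlined, i.e. an overlined entry must be strictly smaller
-- than the entry preceding it.

Entry : Set
Entry = ℕ × Bool

okPair : Entry → Entry → Bool
okPair (a , _) (b , false) = ⌊ b ℕ.≤? a ⌋
okPair (a , _) (b , true)  = ⌊ b ℕ.<? a ⌋

sorted : List Entry → Bool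
sorted []            = true
sorted (x ∷ [])      = true
sorted (x ∷ y ∷ xs)  = okPair x y ∧ sorted (y ∷ xs)

allPositive : List Entry → Bool
allPositive []             = true
allPositive ((a , _) ∷ xs) = ⌊ 1 ℕ.≤? a ⌋ ∧ allPositive xs

partSum : List Entry → ℕ
partSum []             = 0
partSum ((a , _) ∷ xs) = a ℕ.+ partSum xs

isOverpartitionOf : ℕ → List Entry → Bool
isOverpartitionOf n xs = allPositive xs ∧ sorted xs ∧ ⌊ partSum xs ℕ.≟ n ⌋

largestPart : List Entry → ℕ
largestPart []             = 0
largestPart ((a , _) ∷ xs) = a ⊔ largestPart xs

smallestPart : List Entry → ℕ
smallestPart []                   = 0
smallestPart ((a , _) ∷ [])       = a
smallestPart ((a , _) ∷ y ∷ xs)   = a ⊓ smallestPart (y ∷ xs)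

spreadAtMost : ℕ → List Entry → Bool
spreadAtMost t xs = ⌊ largestPart xs ∸ smallestPart xs ℕ.≤? t ⌋

-- Finite search space: all lists of length ≤ n with entries in {0..n} × Bool.
-- Every overpartition of n lies in it, and it contains no duplicates.
entries : ℕ → List Entry
entries n = concatMap (λ a → (a , false) ∷ (a , true) ∷ []) (upTo (suc n))

wordsOfLength : ℕ → List Entry → List (List Entry)
wordsOfLength zero    es = [] ∷ []
wordsOfLength (suc k) es = concatMap (λ e → map (e ∷_) (wordsOfLength k es)) es

candidates : ℕ → List (List Entry)
candidates n = concatMap (λ k → wordsOfLength k (entries n)) (upTo (suc n))

pbar : ℕ → ℕ → ℕ
pbar t n = length (filter (λ xs → T? (isOverpartitionOf n xs ∧ spreadAtMost t xs)) (candidates n))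

Series : Set
Series = ℕ → ℤ

sumℤ : List ℤ → ℤ
sumℤ []       = + 0
sumℤ (x ∷ xs) = x ℤ.+ sumℤ xs

_⊕_ : Series → Series → Series
(f ⊕ g) m = f m ℤ.+ g m

_⊖_ : Series → Series → Series
(f ⊖ g) m = f m ℤ.- g m

_⊗_ : Series → Series → Series
(f ⊗ g) m = sumℤ (map (λ i → f i ℤ.* g (m ∸ i)) (upTo (suc m)))

scale : ℤ → Series → Series
scale c f m = c ℤ.* f m

oneS : Series
oneS zero    = + 1
oneS (suc m) = + 0

qpow : ℕ → Series
qpow k m = if does (k ℕ.≟ m) then + 1 else + 0

-- 1/(1 - q^k) = Σ_{j ≥ 0} q^{k j}   (used for k ≥ 1)
geomInv : ℕ → Series
geomInv k m = if does (k ∣? m) then + 1 else + 0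

prodS : (ℕ → Series) → ℕ → Series
prodS f zero    = oneS
prodS f (suc n) = prodS f n ⊗ f (suc n)

sumS : (ℕ → Series) → ℕ → Series
sumS f zero    m = + 0
sumS f (suc n) m = sumS f n m ℤ.+ f (suc n) m

negQPoch : ℕ → Series
negQPoch = prodS (λ k → oneS ⊕ qpow k)

invQPoch : ℕ → Series
invQPoch = prodS geomInv

d : ℕ → ℕ
d n = length (filter (λ k → k ∣? n) (map suc (upTo n)))

dSeries : Series
dSeries zero    = + 0
dSeries (suc m) = + d (suc m)

term : ℕ → Series
term n = scale ((- + 1) ^ n) (geomInv n ⊗ ((negQPoch n ⊗ invQPoch n) ⊖ oneS))

rhs : ℕ → Series
rhs t = scale (+ 2 ℤ.* (- + 1) ^ t) (dSeries ⊕ sumS term t)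

lhs : ℕ → Series
lhs t zero    = + 0
lhs t (suc m) = + pbar t (suc m)

-- Write W(l, c) = ∏_{k=l+1}^{l+c} (1 + q^k)/(1 - q^k), the generating function of overpartitions with all
-- parts in (l, l + c]. An overpartition with smallest part μ and largest part M is counted by W(l, t + 1) - W(l + 1, t)
-- exactly when l = μ - 1 and M - μ ≤ t, so p̄_t(m) is the coefficient of q^m in D_t = Σ_{l<m} (W(l, t + 1) - W(l + 1, t)).
-- The cross-ratio relation between (1 + q^a)/(1 - q^a) and (1 + q^{a+b})/(1 - q^{a+b}) gives, termwise in l,
-- D_{t+1} + D_t = 2/(1 - q^{t+1}) Σ_l (W(l, t + 1) - W(l + 1, t + 1)), which telescopes to
-- 2/(1 - q^{t+1}) ((-q;q)_{t+1}/(q;q)_{t+1} - 1) in degree m. Since the coefficients of D_0 are 2 d(m),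
-- induction on t yields the formula.
module Submission where

open import Algebra.Bundles using (CommutativeRing; CommutativeMonoid)
open import Data.Bool using (Bool; true; false; T; _∧_; if_then_else_)
import Data.Bool.Properties
open Data.Bool.Properties using (∧-zeroʳ; ∧-identityʳ; ∧-assoc)
open import Data.Bool.Solver using (module ∨-∧-Solver)
open import Data.Empty using (⊥-elim)
open import Data.Integer as ℤ using (ℤ; +_; -_; _+_; _*_; _-_)
import Data.Integer.Properties as ℤ
open import Data.Integer.Tactic.RingSolver using (solve-∀)
open import Data.List using (List; []; _∷_; _++_; map; concatMap; upTo; applyUpTo; filter; length)
import Data.List.Properties as List
open import Data.Nat as ℕ using (ℕ; zero; suc; _∸_; z≤n; s≤s; _⊔_; _⊓_)
import Data.Nat.Properties as ℕ
open import Data.Nat.Divisibility using (_∣_; _∣?_; ∣-refl; _∣0; ∣⇒≤; ∣m+n∣m⇒∣n; ∣m∸n∣n⇒∣m)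
open import Data.Product using (_×_; _,_; proj₁; proj₂)
open import Data.Unit using (tt)
open import Function using (_∘_)
open import Level using (0ℓ)
open import Relation.Binary.Definitions using (tri<; tri≈; tri>)
open import Relation.Binary.PropositionalEquality
import Relation.Binary.Reasoning.Setoid
open import Relation.Nullary using (¬_; Dec; yes; no; does)
open import Relation.Nullary.Decidable using (⌊_⌋; T?; dec-true; dec-false; isYes≗does; toWitness)
open import Relation.Unary using (Decidable)

open import Defs

open import Algebra.Properties.CommutativeSemigroup ℤ.+-commutativeSemigroup
  using () renaming (interchange to +-interchange)
open import Algebra.Properties.CommutativeSemigroup
  (CommutativeMonoid.commutativeSemigroup Data.Bool.Properties.∧-commutativeMonoid)
  using () renaming (interchange to ∧-interchange)

𝟙 : Bool → ℤ
𝟙 b = if b then + 1 else + 0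

⌊⌋-true : ∀ {A : Set} (a? : Dec A) → A → ⌊ a? ⌋ ≡ true
⌊⌋-true a? a = trans (isYes≗does a?) (dec-true a? a)

⌊⌋-false : ∀ {A : Set} (a? : Dec A) → ¬ A → ⌊ a? ⌋ ≡ false
⌊⌋-false a? ¬a = trans (isYes≗does a?) (dec-false a? ¬a)

does-cong : ∀ {A B : Set} (a? : Dec A) (b? : Dec B) → (A → B) → (B → A) → does a? ≡ does b?
does-cong (yes a) b? to from = sym (dec-true b? (to a))
does-cong (no ¬a) b? to from = sym (dec-false b? (¬a ∘ from))

⌊⌋-cong : ∀ {A B : Set} (a? : Dec A) (b? : Dec B) → (A → B) → (B → A) → ⌊ a? ⌋ ≡ ⌊ b? ⌋
⌊⌋-cong a? b? to from = trans (isYes≗does a?) (trans (does-cong a? b? to from) (sym (isYes≗does b?)))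

⌊⌋-∧ : ∀ {A B C : Set} (a? : Dec A) (b? : Dec B) (c? : Dec C) → (C → A × B) → (A → B → C) → ⌊ c? ⌋ ≡ ⌊ a? ⌋ ∧ ⌊ b? ⌋
⌊⌋-∧ (yes a) (yes b) c? split join = ⌊⌋-true c? (join a b)
⌊⌋-∧ (yes a) (no ¬b) c? split join = ⌊⌋-false c? (¬b ∘ proj₂ ∘ split)
⌊⌋-∧ (no ¬a) b?      c? split join = ⌊⌋-false c? (¬a ∘ proj₁ ∘ split)

∑ : ℕ → (ℕ → ℤ) → ℤ
∑ zero    f = + 0
∑ (suc n) f = f 0 + ∑ n (f ∘ suc)

∑-cong< : ∀ n {f g : ℕ → ℤ} → (∀ i → i ℕ.< n → f i ≡ g i) → ∑ n f ≡ ∑ n g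
∑-cong< zero    eq = refl
∑-cong< (suc n) eq = cong₂ _+_ (eq 0 (s≤s z≤n)) (∑-cong< n (λ i i<n → eq (suc i) (s≤s i<n)))

∑-cong : ∀ n {f g : ℕ → ℤ} → (∀ i → f i ≡ g i) → ∑ n f ≡ ∑ n g
∑-cong n eq = ∑-cong< n (λ i _ → eq i)

∑-zero : ∀ n {f : ℕ → ℤ} → (∀ i → i ℕ.< n → f i ≡ + 0) → ∑ n f ≡ + 0
∑-zero n {f} eq = trans (∑-cong< n eq) (∑-const0 n)
  where
  ∑-const0 : ∀ n → ∑ n (λ _ → + 0) ≡ + 0
  ∑-const0 zero    = refl
  ∑-const0 (suc n) = trans (ℤ.+-identityˡ _) (∑-const0 n)

∑-+ : ∀ n (f g : ℕ → ℤ) → ∑ n (λ i → f i + g i) ≡ ∑ n f + ∑ n g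
∑-+ zero    f g = refl
∑-+ (suc n) f g = trans (cong (_+_ (f 0 + g 0)) (∑-+ n (f ∘ suc) (g ∘ suc)))
                        (+-interchange (f 0) (g 0) _ _)

∑-neg : ∀ n (f : ℕ → ℤ) → ∑ n (λ i → - f i) ≡ - ∑ n f
∑-neg zero    f = refl
∑-neg (suc n) f = trans (cong (_+_ (- f 0)) (∑-neg n (f ∘ suc))) (sym (ℤ.neg-distrib-+ (f 0) _))

∑-*ˡ : ∀ n c (f : ℕ → ℤ) → ∑ n (λ i → c * f i) ≡ c * ∑ n f
∑-*ˡ zero    c f = sym (ℤ.*-zeroʳ c)
∑-*ˡ (suc n) c f = trans (cong (_+_ (c * f 0)) (∑-*ˡ n c (f ∘ suc))) (sym (ℤ.*-distribˡ-+ c (f 0) _))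

∑-*ʳ : ∀ n c (f : ℕ → ℤ) → ∑ n (λ i → f i * c) ≡ ∑ n f * c
∑-*ʳ n c f = trans (∑-cong n (λ i → ℤ.*-comm (f i) c)) (trans (∑-*ˡ n c f) (ℤ.*-comm c _))

∑-snoc : ∀ n (f : ℕ → ℤ) → ∑ (suc n) f ≡ ∑ n f + f n
∑-snoc zero    f = trans (ℤ.+-identityʳ (f 0)) (sym (ℤ.+-identityˡ (f 0)))
∑-snoc (suc n) f = trans (cong (_+_ (f 0)) (∑-snoc n (f ∘ suc))) (sym (ℤ.+-assoc (f 0) _ _))

∑-reverse : ∀ n (f : ℕ → ℤ) → ∑ n f ≡ ∑ n (λ i → f (n ∸ suc i))
∑-reverse zero    f = refl
∑-reverse (suc n) f = begin
  f 0 + ∑ n (f ∘ suc)                                      ≡⟨ cong (_+_ (f 0)) (∑-reverse n (f ∘ suc)) ⟩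
  f 0 + ∑ n (λ i → f (suc (n ∸ suc i)))                    ≡⟨ ℤ.+-comm (f 0) _ ⟩
  ∑ n (λ i → f (suc (n ∸ suc i))) + f 0                    ≡⟨ cong₂ _+_ (∑-cong< n λ i i<n → cong f (sym (ℕ.+-∸-assoc 1 i<n)))
                                                                        (cong f (sym (ℕ.n∸n≡0 n))) ⟩
  ∑ n (λ i → f (suc n ∸ suc i)) + f (suc n ∸ suc n)        ≡⟨ sym (∑-snoc n (λ i → f (suc n ∸ suc i))) ⟩
  ∑ (suc n) (λ i → f (suc n ∸ suc i))                      ∎
  where open ≡-Reasoning

∑-swap : ∀ n m (F : ℕ → ℕ → ℤ) → ∑ n (λ i → ∑ m (F i)) ≡ ∑ m (λ j → ∑ n (λ i → F i j))
∑-swap zero    m F = sym (∑-zero m (λ _ _ → refl))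
∑-swap (suc n) m F = trans (cong (_+_ (∑ m (F 0))) (∑-swap n m (F ∘ suc)))
                           (sym (∑-+ m (F 0) (λ j → ∑ n (λ i → F (suc i) j))))

∑-single : ∀ n p (f : ℕ → ℤ) → p ℕ.< n → (∀ i → i ℕ.< n → i ≢ p → f i ≡ + 0) → ∑ n f ≡ f p
∑-single (suc n) zero f _ others =
  trans (cong (_+_ (f 0)) (∑-zero n (λ i i<n → others (suc i) (s≤s i<n) (λ ())))) (ℤ.+-identityʳ (f 0))
∑-single (suc n) (suc p) f (s≤s p<n) others =
  trans (cong (_+ ∑ n (f ∘ suc)) (others 0 (s≤s z≤n) (λ ())))
        (trans (ℤ.+-identityˡ _)
               (∑-single n p (f ∘ suc) p<n (λ i i<n i≢p → others (suc i) (s≤s i<n) (i≢p ∘ ℕ.suc-injective))))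

∑-extend : ∀ m k (f : ℕ → ℤ) → (∀ i → m ℕ.≤ i → f i ≡ + 0) → ∑ (m ℕ.+ k) f ≡ ∑ m f
∑-extend zero    k f vanish = ∑-zero k (λ i _ → vanish i z≤n)
∑-extend (suc m) k f vanish = cong (_+_ (f 0)) (∑-extend m k (f ∘ suc) (λ i m≤i → vanish (suc i) (s≤s m≤i)))

∑-triangle : ∀ m (F : ℕ → ℕ → ℤ) →
  ∑ (suc m) (λ i → ∑ (suc i) (F i)) ≡ ∑ (suc m) (λ j → ∑ (suc m ∸ j) (λ k → F (j ℕ.+ k) j))
∑-triangle zero    F = refl
∑-triangle (suc m) F = begin
  ∑ (suc (suc m)) (λ i → ∑ (suc i) (F i))
    ≡⟨ ∑-snoc (suc m) (λ i → ∑ (suc i) (F i)) ⟩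
  ∑ (suc m) (λ i → ∑ (suc i) (F i)) + ∑ (suc (suc m)) (F (suc m))
    ≡⟨ cong (_+ ∑ (suc (suc m)) (F (suc m))) (∑-triangle m F) ⟩
  ∑ (suc m) G + ∑ (suc (suc m)) (F (suc m))
    ≡⟨ cong (_+ ∑ (suc (suc m)) (F (suc m))) lastEmpty ⟩
  ∑ (suc (suc m)) G + ∑ (suc (suc m)) (F (suc m))
    ≡⟨ sym (∑-+ (suc (suc m)) G (F (suc m))) ⟩
  ∑ (suc (suc m)) (λ j → G j + F (suc m) j)
    ≡⟨ ∑-cong< (suc (suc m)) (λ j j<m+2 → extendRow j (ℕ.≤-pred j<m+2)) ⟩
  ∑ (suc (suc m)) (λ j → ∑ (suc (suc m) ∸ j) (λ k → F (j ℕ.+ k) j))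
    ∎
  where
  open ≡-Reasoning
  G : ℕ → ℤ
  G j = ∑ (suc m ∸ j) (λ k → F (j ℕ.+ k) j)
  lastEmpty : ∑ (suc m) G ≡ ∑ (suc (suc m)) G
  lastEmpty = sym (trans (∑-snoc (suc m) G)
                         (trans (cong (λ n → ∑ (suc m) G + ∑ n (λ k → F (suc m ℕ.+ k) (suc m))) (ℕ.n∸n≡0 m)) (ℤ.+-identityʳ _)))
  extendRow : ∀ j → j ℕ.≤ suc m → G j + F (suc m) j ≡ ∑ (suc (suc m) ∸ j) (λ k → F (j ℕ.+ k) j)
  extendRow j j≤ = begin
    G j + F (suc m) j                                       ≡⟨ cong (λ i → G j + F i j) (sym (ℕ.m+[n∸m]≡n j≤)) ⟩
    G j + F (j ℕ.+ (suc m ∸ j)) j                           ≡⟨ sym (∑-snoc (suc m ∸ j) (λ k → F (j ℕ.+ k) j)) ⟩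
    ∑ (suc (suc m ∸ j)) (λ k → F (j ℕ.+ k) j)               ≡⟨ cong (λ n → ∑ n (λ k → F (j ℕ.+ k) j)) (ℕ.+-∸-assoc 1 j≤) ⟨
    ∑ (suc (suc m) ∸ j) (λ k → F (j ℕ.+ k) j)               ∎

sumℤ-map-upTo : ∀ (f : ℕ → ℤ) n → sumℤ (map f (upTo n)) ≡ ∑ n f
sumℤ-map-upTo f n = trans (cong sumℤ (List.map-applyUpTo (λ i → i) f n)) (sumℤ-applyUpTo f n)
  where
  sumℤ-applyUpTo : ∀ (f : ℕ → ℤ) n → sumℤ (applyUpTo f n) ≡ ∑ n f
  sumℤ-applyUpTo f zero    = refl
  sumℤ-applyUpTo f (suc n) = cong (_+_ (f 0)) (sumℤ-applyUpTo (f ∘ suc) n)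

-- Formal power series

infix 4 _≈_
record _≈_ (f g : Series) : Set where
  constructor coeffwise
  field coeff : ∀ m → f m ≡ g m
open _≈_ public

negS : Series → Series
negS f m = - f m

constS : ℤ → Series
constS c = scale c oneS

oneS-≥1 : ∀ {m} → 1 ℕ.≤ m → oneS m ≡ + 0
oneS-≥1 {suc m} _ = refl

⊗-coeff : ∀ f g m → (f ⊗ g) m ≡ ∑ (suc m) (λ i → f i * g (m ∸ i))
⊗-coeff f g m = sumℤ-map-upTo (λ i → f i * g (m ∸ i)) (suc m)

⊗-congUpTo : ∀ {f f′ g g′} m → (∀ i → i ℕ.≤ m → f i ≡ f′ i) → (∀ i → i ℕ.≤ m → g i ≡ g′ i) →
             (f ⊗ g) m ≡ (f′ ⊗ g′) m
⊗-congUpTo {f} {f′} {g} {g′} m eqf eqg = begin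
  (f ⊗ g) m                                ≡⟨ ⊗-coeff f g m ⟩
  ∑ (suc m) (λ i → f i * g (m ∸ i))        ≡⟨ ∑-cong< (suc m) (λ i i<1+m →
                                                 cong₂ _*_ (eqf i (ℕ.≤-pred i<1+m)) (eqg (m ∸ i) (ℕ.m∸n≤m m i))) ⟩
  ∑ (suc m) (λ i → f′ i * g′ (m ∸ i))      ≡⟨ sym (⊗-coeff f′ g′ m) ⟩
  (f′ ⊗ g′) m                              ∎
  where open ≡-Reasoning

⊗-cong : ∀ {f f′ g g′} → f ≈ f′ → g ≈ g′ → f ⊗ g ≈ f′ ⊗ g′
⊗-cong eqf eqg .coeff m = ⊗-congUpTo m (λ i _ → eqf .coeff i) (λ i _ → eqg .coeff i)

⊗-congˡ : ∀ {f f′} g → f ≈ f′ → f ⊗ g ≈ f′ ⊗ g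
⊗-congˡ {f} {f′} g eq = ⊗-cong {f} {f′} {g} {g} eq (coeffwise (λ _ → refl))

⊗-congʳ : ∀ f {g g′} → g ≈ g′ → f ⊗ g ≈ f ⊗ g′
⊗-congʳ f {g} {g′} eq = ⊗-cong {f} {f} {g} {g′} (coeffwise (λ _ → refl)) eq

⊕-cong : ∀ {f f′ g g′} → f ≈ f′ → g ≈ g′ → f ⊕ g ≈ f′ ⊕ g′
⊕-cong eqf eqg .coeff m = cong₂ _+_ (eqf .coeff m) (eqg .coeff m)

⊕-congˡ : ∀ {f f′} g → f ≈ f′ → f ⊕ g ≈ f′ ⊕ g
⊕-congˡ {f} {f′} g eq = ⊕-cong {f} {f′} {g} {g} eq (coeffwise (λ _ → refl))

⊕-congʳ : ∀ f {g g′} → g ≈ g′ → f ⊕ g ≈ f ⊕ g′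
⊕-congʳ f {g} {g′} eq = ⊕-cong {f} {f} {g} {g′} (coeffwise (λ _ → refl)) eq

negS-cong : ∀ {f f′} → f ≈ f′ → negS f ≈ negS f′
negS-cong eq .coeff m = cong -_ (eq .coeff m)

⊗-comm : ∀ f g → f ⊗ g ≈ g ⊗ f
⊗-comm f g .coeff m = begin
  (f ⊗ g) m                                          ≡⟨ ⊗-coeff f g m ⟩
  ∑ (suc m) (λ i → f i * g (m ∸ i))                  ≡⟨ ∑-reverse (suc m) (λ i → f i * g (m ∸ i)) ⟩
  ∑ (suc m) (λ i → f (m ∸ i) * g (m ∸ (m ∸ i)))      ≡⟨ ∑-cong< (suc m) (λ i i<1+m →
                                                         trans (ℤ.*-comm (f (m ∸ i)) (g (m ∸ (m ∸ i))))
                                                               (cong (λ j → g j * f (m ∸ i)) (ℕ.m∸[m∸n]≡n (ℕ.≤-pred i<1+m)))) ⟩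
  ∑ (suc m) (λ i → g i * f (m ∸ i))                  ≡⟨ sym (⊗-coeff g f m) ⟩
  (g ⊗ f) m                                          ∎
  where open ≡-Reasoning

⊗-assoc : ∀ f g h → (f ⊗ g) ⊗ h ≈ f ⊗ (g ⊗ h)
⊗-assoc f g h .coeff m = begin
  ((f ⊗ g) ⊗ h) m
    ≡⟨ ⊗-coeff (f ⊗ g) h m ⟩
  ∑ (suc m) (λ i → (f ⊗ g) i * h (m ∸ i))
    ≡⟨ ∑-cong (suc m) (λ i → trans (cong (_* h (m ∸ i)) (⊗-coeff f g i))
                                   (sym (∑-*ʳ (suc i) (h (m ∸ i)) (λ j → f j * g (i ∸ j))))) ⟩
  ∑ (suc m) (λ i → ∑ (suc i) (λ j → f j * g (i ∸ j) * h (m ∸ i)))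
    ≡⟨ ∑-triangle m (λ i j → f j * g (i ∸ j) * h (m ∸ i)) ⟩
  ∑ (suc m) (λ j → ∑ (suc m ∸ j) (λ k → f j * g (j ℕ.+ k ∸ j) * h (m ∸ (j ℕ.+ k))))
    ≡⟨ ∑-cong< (suc m) (λ j j<1+m → column j (ℕ.≤-pred j<1+m)) ⟩
  ∑ (suc m) (λ j → f j * (g ⊗ h) (m ∸ j))
    ≡⟨ sym (⊗-coeff f (g ⊗ h) m) ⟩
  (f ⊗ (g ⊗ h)) m
    ∎
  where
  open ≡-Reasoning
  column : ∀ j → j ℕ.≤ m → ∑ (suc m ∸ j) (λ k → f j * g (j ℕ.+ k ∸ j) * h (m ∸ (j ℕ.+ k))) ≡ f j * (g ⊗ h) (m ∸ j)
  column j j≤m = begin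
    ∑ (suc m ∸ j) (λ k → f j * g (j ℕ.+ k ∸ j) * h (m ∸ (j ℕ.+ k)))
      ≡⟨ cong (λ n → ∑ n (λ k → f j * g (j ℕ.+ k ∸ j) * h (m ∸ (j ℕ.+ k)))) (ℕ.+-∸-assoc 1 j≤m) ⟩
    ∑ (suc (m ∸ j)) (λ k → f j * g (j ℕ.+ k ∸ j) * h (m ∸ (j ℕ.+ k)))
      ≡⟨ ∑-cong (suc (m ∸ j)) (λ k → trans (cong₂ (λ a b → f j * g a * h b) (ℕ.m+n∸m≡n j k) (sym (ℕ.∸-+-assoc m j k)))
                                            (ℤ.*-assoc (f j) (g k) _)) ⟩
    ∑ (suc (m ∸ j)) (λ k → f j * (g k * h (m ∸ j ∸ k)))
      ≡⟨ ∑-*ˡ (suc (m ∸ j)) (f j) (λ k → g k * h (m ∸ j ∸ k)) ⟩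
    f j * ∑ (suc (m ∸ j)) (λ k → g k * h (m ∸ j ∸ k))
      ≡⟨ cong (f j *_) (sym (⊗-coeff g h (m ∸ j))) ⟩
    f j * (g ⊗ h) (m ∸ j)
      ∎

⊗-distribˡ : ∀ f g h → f ⊗ (g ⊕ h) ≈ (f ⊗ g) ⊕ (f ⊗ h)
⊗-distribˡ f g h .coeff m = begin
  (f ⊗ (g ⊕ h)) m                                                ≡⟨ ⊗-coeff f (g ⊕ h) m ⟩
  ∑ (suc m) (λ i → f i * (g (m ∸ i) + h (m ∸ i)))
                                                                 ≡⟨ ∑-cong (suc m) (λ i → ℤ.*-distribˡ-+ (f i) (g (m ∸ i)) (h (m ∸ i))) ⟩
  ∑ (suc m) (λ i → f i * g (m ∸ i) + f i * h (m ∸ i))            ≡⟨ ∑-+ (suc m) (λ i → f i * g (m ∸ i)) (λ i → f i * h (m ∸ i)) ⟩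
  ∑ (suc m) (λ i → f i * g (m ∸ i)) + ∑ (suc m) (λ i → f i * h (m ∸ i))
                                                                 ≡⟨ sym (cong₂ _+_ (⊗-coeff f g m) (⊗-coeff f h m)) ⟩
  ((f ⊗ g) ⊕ (f ⊗ h)) m                                          ∎
  where open ≡-Reasoning

⊗-identityˡ : ∀ f → oneS ⊗ f ≈ f
⊗-identityˡ f .coeff m = begin
  (oneS ⊗ f) m                                  ≡⟨ ⊗-coeff oneS f m ⟩
  + 1 * f m + ∑ m (λ i → + 0 * f (m ∸ suc i))   ≡⟨ cong (_+_ (+ 1 * f m)) (∑-zero m (λ _ _ → refl)) ⟩
  + 1 * f m + + 0                               ≡⟨ ℤ.+-identityʳ _ ⟩
  + 1 * f m                                     ≡⟨ ℤ.*-identityˡ (f m) ⟩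
  f m                                           ∎
  where open ≡-Reasoning

Series-commutativeRing : CommutativeRing 0ℓ 0ℓ
Series-commutativeRing = record
  { Carrier = Series
  ; _≈_ = _≈_
  ; _+_ = _⊕_
  ; _*_ = _⊗_
  ; -_ = negS
  ; 0# = λ _ → + 0
  ; 1# = oneS
  ; isCommutativeRing = record
    { isRing = record
      { +-isAbelianGroup = record
        { isGroup = record
          { isMonoid = record
            { isSemigroup = record
              { isMagma = record
                { isEquivalence = record
                  { refl  = coeffwise (λ _ → refl)
                  ; sym   = λ eq → coeffwise (λ m → sym (eq .coeff m))
                  ; trans = λ eq eq′ → coeffwise (λ m → trans (eq .coeff m) (eq′ .coeff m)) }
                ; ∙-cong = ⊕-cong }
              ; assoc = λ f g h → coeffwise (λ m → ℤ.+-assoc (f m) (g m) (h m)) }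
            ; identity = (λ f → coeffwise (λ m → ℤ.+-identityˡ (f m))) , (λ f → coeffwise (λ m → ℤ.+-identityʳ (f m))) }
          ; inverse = (λ f → coeffwise (λ m → ℤ.+-inverseˡ (f m))) , (λ f → coeffwise (λ m → ℤ.+-inverseʳ (f m)))
          ; ⁻¹-cong = negS-cong }
        ; comm = λ f g → coeffwise (λ m → ℤ.+-comm (f m) (g m)) }
      ; *-cong = ⊗-cong
      ; *-assoc = ⊗-assoc
      ; *-identity = ⊗-identityˡ , (λ f → coeffwise (λ m → trans (⊗-comm f oneS .coeff m) (⊗-identityˡ f .coeff m)))
      ; distrib = ⊗-distribˡ
                , (λ f g h → coeffwise (λ m → trans (⊗-comm (g ⊕ h) f .coeff m)
                     (trans (⊗-distribˡ f g h .coeff m) (cong₂ _+_ (⊗-comm f g .coeff m) (⊗-comm f h .coeff m)))))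
      }
    ; *-comm = ⊗-comm
    }
  }

constS-⊗ : ∀ c f → constS c ⊗ f ≈ scale c f
constS-⊗ c f .coeff m = begin
  (constS c ⊗ f) m                               ≡⟨ ⊗-coeff (constS c) f m ⟩
  ∑ (suc m) (λ i → c * oneS i * f (m ∸ i))       ≡⟨ ∑-cong (suc m) (λ i → ℤ.*-assoc c (oneS i) (f (m ∸ i))) ⟩
  ∑ (suc m) (λ i → c * (oneS i * f (m ∸ i)))     ≡⟨ ∑-*ˡ (suc m) c (λ i → oneS i * f (m ∸ i)) ⟩
  c * ∑ (suc m) (λ i → oneS i * f (m ∸ i))       ≡⟨ cong (c *_) (trans (sym (⊗-coeff oneS f m)) (⊗-identityˡ f .coeff m)) ⟩
  c * f m                                        ∎
  where open ≡-Reasoning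

module SeriesSolver where
  open import Algebra.Solver.Ring.AlmostCommutativeRing
    using (fromCommutativeRing; _-Raw-AlmostCommutative⟶_)
  open import Data.Maybe using (Maybe; just; nothing)

  constS-morphism : CommutativeRing.rawRing ℤ.+-*-commutativeRing -Raw-AlmostCommutative⟶
                    fromCommutativeRing Series-commutativeRing
  constS-morphism = record
    { ⟦_⟧    = constS
    ; +-homo = λ a b → coeffwise (λ m → ℤ.*-distribʳ-+ (oneS m) a b)
    ; *-homo = λ a b → coeffwise (λ m → trans (ℤ.*-assoc a b (oneS m)) (sym (constS-⊗ a (constS b) .coeff m)))
    ; -‿homo = λ a → coeffwise (λ m → sym (ℤ.neg-distribˡ-* a (oneS m)))
    ; 0-homo = coeffwise (λ m → ℤ.*-zeroˡ (oneS m))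
    ; 1-homo = coeffwise (λ m → ℤ.*-identityˡ (oneS m))
    }

  constS-≟ : ∀ a b → Maybe (constS a ≈ constS b)
  constS-≟ a b with a ℤ.≟ b
  ... | yes refl = just (coeffwise (λ _ → refl))
  ... | no _     = nothing

  open import Algebra.Solver.Ring _ _ constS-morphism constS-≟ public

qpow-≢ : ∀ {k i} → k ≢ i → qpow k i ≡ + 0
qpow-≢ {k} {i} k≢i = cong 𝟙 (dec-false (k ℕ.≟ i) k≢i)

qpow-⊗-≥ : ∀ k X m → k ℕ.≤ m → (qpow k ⊗ X) m ≡ X (m ∸ k)
qpow-⊗-≥ k X m k≤m = begin
  (qpow k ⊗ X) m                           ≡⟨ ⊗-coeff (qpow k) X m ⟩
  ∑ (suc m) (λ i → qpow k i * X (m ∸ i))   ≡⟨ ∑-single (suc m) k _ (s≤s k≤m)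
                                                (λ i _ i≢k → cong (_* X (m ∸ i)) (qpow-≢ (i≢k ∘ sym))) ⟩
  qpow k k * X (m ∸ k)                     ≡⟨ cong (λ b → 𝟙 b * X (m ∸ k)) (dec-true (k ℕ.≟ k) refl) ⟩
  + 1 * X (m ∸ k)                          ≡⟨ ℤ.*-identityˡ _ ⟩
  X (m ∸ k)                                ∎
  where open ≡-Reasoning

qpow-⊗-< : ∀ k X m → m ℕ.< k → (qpow k ⊗ X) m ≡ + 0
qpow-⊗-< k X m m<k = trans (⊗-coeff (qpow k) X m)
  (∑-zero (suc m) (λ i i≤m → cong (_* X (m ∸ i)) (qpow-≢ {k} {i} (λ k≡i → ℕ.<-irrefl (sym k≡i) (ℕ.<-≤-trans i≤m m<k)))))

qpow-+ : ∀ a b → qpow a ⊗ qpow b ≈ qpow (a ℕ.+ b)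
qpow-+ a b .coeff m with a ℕ.≤? m
... | no a≰m = trans (qpow-⊗-< a (qpow b) m (ℕ.≰⇒> a≰m))
                     (sym (qpow-≢ (λ a+b≡m → a≰m (subst (a ℕ.≤_) a+b≡m (ℕ.m≤m+n a b)))))
... | yes a≤m = trans (qpow-⊗-≥ a (qpow b) m a≤m) (cong 𝟙 (does-cong (b ℕ.≟ m ∸ a) (a ℕ.+ b ℕ.≟ m) to from))
  where
  to : b ≡ m ∸ a → a ℕ.+ b ≡ m
  to b≡m∸a = trans (cong (a ℕ.+_) b≡m∸a) (ℕ.m+[n∸m]≡n a≤m)
  from : a ℕ.+ b ≡ m → b ≡ m ∸ a
  from a+b≡m = trans (sym (ℕ.m+n∸m≡n a b)) (cong (_∸ a) a+b≡m)

geomInv-< : ∀ k m → m ℕ.< k → geomInv k m ≡ oneS m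
geomInv-< k zero    _   = cong 𝟙 (dec-true (k ∣? 0) (k ∣0))
geomInv-< k (suc m) m<k = cong 𝟙 (dec-false (k ∣? suc m) (λ k∣1+m → ℕ.<⇒≱ m<k (∣⇒≤ k∣1+m)))

geomInv-shift : ∀ k m → k ℕ.≤ m → (qpow k ⊗ geomInv k) m ≡ geomInv k m
geomInv-shift k m k≤m = trans (qpow-⊗-≥ k (geomInv k) m k≤m) (cong 𝟙 (does-cong (k ∣? m ∸ k) (k ∣? m) to from))
  where
  to : k ∣ m ∸ k → k ∣ m
  to k∣m∸k = ∣m∸n∣n⇒∣m k k≤m k∣m∸k ∣-refl
  from : k ∣ m → k ∣ m ∸ k
  from k∣m = ∣m+n∣m⇒∣n (subst (k ∣_) (sym (ℕ.m+[n∸m]≡n k≤m)) k∣m) ∣-refl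

oneS⊕-⊗ : ∀ X Y m → ((oneS ⊕ X) ⊗ Y) m ≡ Y m + (X ⊗ Y) m
oneS⊕-⊗ X Y m = trans (distribʳ Y oneS X .coeff m) (cong (_+ (X ⊗ Y) m) (⊗-identityˡ Y .coeff m))
  where open CommutativeRing Series-commutativeRing using (distribʳ)

geomInv-inverse : ∀ k → 1 ℕ.≤ k → (oneS ⊕ negS (qpow k)) ⊗ geomInv k ≈ oneS
geomInv-inverse k 1≤k .coeff m = begin
  ((oneS ⊕ negS (qpow k)) ⊗ geomInv k) m         ≡⟨ oneS⊕-⊗ (negS (qpow k)) (geomInv k) m ⟩
  geomInv k m + (negS (qpow k) ⊗ geomInv k) m    ≡⟨ cong (_+_ (geomInv k m)) neg-shift ⟩
  geomInv k m - (qpow k ⊗ geomInv k) m           ≡⟨ byDegree (k ℕ.≤? m) ⟩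
  oneS m                                         ∎
  where
  open ≡-Reasoning
  neg-shift : (negS (qpow k) ⊗ geomInv k) m ≡ - (qpow k ⊗ geomInv k) m
  neg-shift = trans (⊗-coeff (negS (qpow k)) (geomInv k) m)
    (trans (∑-cong (suc m) (λ i → sym (ℤ.neg-distribˡ-* (qpow k i) (geomInv k (m ∸ i)))))
           (trans (∑-neg (suc m) (λ i → qpow k i * geomInv k (m ∸ i))) (cong -_ (sym (⊗-coeff (qpow k) (geomInv k) m)))))
  byDegree : Dec (k ℕ.≤ m) → geomInv k m - (qpow k ⊗ geomInv k) m ≡ oneS m
  byDegree (yes k≤m) = trans (cong (_-_ (geomInv k m)) (geomInv-shift k m k≤m))
                             (trans (ℤ.+-inverseʳ (geomInv k m)) (sym (oneS-≥1 (ℕ.<-≤-trans 1≤k k≤m))))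
  byDegree (no k≰m)  = trans (cong₂ _-_ (geomInv-< k m (ℕ.≰⇒> k≰m)) (qpow-⊗-< k (geomInv k) m (ℕ.≰⇒> k≰m)))
                             (ℤ.+-identityʳ (oneS m))

module SR = CommutativeRing Series-commutativeRing
module ≈-Reasoning = Relation.Binary.Reasoning.Setoid SR.setoid

oneS≈1 : oneS ≈ constS (+ 1)
oneS≈1 .coeff m = sym (ℤ.*-identityˡ (oneS m))

-- The factor (1 + q^k)/(1 - q^k) of the overpartition generating function.
ratio : ℕ → Series
ratio k = (oneS ⊕ qpow k) ⊗ geomInv k

ratio-< : ∀ k m → m ℕ.< k → ratio k m ≡ oneS m
ratio-< k m m<k = trans (oneS⊕-⊗ (qpow k) (geomInv k) m)
  (trans (cong₂ _+_ (geomInv-< k m m<k) (qpow-⊗-< k (geomInv k) m m<k)) (ℤ.+-identityʳ (oneS m)))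

ratio-coeff : ∀ k m → 1 ℕ.≤ m → ratio k m ≡ + 2 * 𝟙 (does (k ∣? m))
ratio-coeff k m 1≤m = trans (oneS⊕-⊗ (qpow k) (geomInv k) m) (byDegree (k ℕ.≤? m))
  where
  byDegree : Dec (k ℕ.≤ m) → geomInv k m + (qpow k ⊗ geomInv k) m ≡ + 2 * geomInv k m
  byDegree (yes k≤m) = trans (cong (_+_ (geomInv k m)) (geomInv-shift k m k≤m)) (double (geomInv k m))
    where
    double : ∀ a → a + a ≡ + 2 * a
    double = solve-∀
  byDegree (no k≰m) = begin
    geomInv k m + (qpow k ⊗ geomInv k) m    ≡⟨ cong₂ _+_ g≡0 (qpow-⊗-< k (geomInv k) m (ℕ.≰⇒> k≰m)) ⟩
    + 0                                     ≡⟨ cong (+ 2 *_) g≡0 ⟨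
    + 2 * geomInv k m                       ∎
    where
    open ≡-Reasoning
    g≡0 : geomInv k m ≡ + 0
    g≡0 = trans (geomInv-< k m (ℕ.≰⇒> k≰m)) (oneS-≥1 1≤m)

-- The solver interprets integer constants through constS, so its unit is 1ₛ rather than oneS.
1ₛ 2ₛ : Series
1ₛ = constS (+ 1)
2ₛ = constS (+ 2)

1-q^k-inverse : ∀ k → 1 ℕ.≤ k → (1ₛ ⊕ negS (qpow k)) ⊗ geomInv k ≈ 1ₛ
1-q^k-inverse k 1≤k = SR.trans (⊗-congˡ (geomInv k) (⊕-congˡ (negS (qpow k)) (SR.sym oneS≈1)))
                               (SR.trans (geomInv-inverse k 1≤k) oneS≈1)

ratio≈ : ∀ k → ratio k ≈ (1ₛ ⊕ qpow k) ⊗ geomInv k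
ratio≈ k = ⊗-congˡ (geomInv k) (⊕-congˡ (qpow k) oneS≈1)

ratio-minus-one : ∀ k → 1 ℕ.≤ k → ratio k ⊕ negS 1ₛ ≈ 2ₛ ⊗ (qpow k ⊗ geomInv k)
ratio-minus-one k 1≤k = begin
  ratio k ⊕ negS 1ₛ                                         ≈⟨ ⊕-cong (ratio≈ k) (negS-cong (SR.sym (1-q^k-inverse k 1≤k))) ⟩
  ((1ₛ ⊕ x) ⊗ g) ⊕ negS ((1ₛ ⊕ negS x) ⊗ g)                 ≈⟨ solve 2 (λ x g → (con (+ 1) :+ x) :* g :- (con (+ 1) :- x) :* g
                                                                              := con (+ 2) :* (x :* g)) SR.refl x g ⟩
  2ₛ ⊗ (x ⊗ g)                                              ∎
  where
  open SeriesSolver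
  open ≈-Reasoning
  x = qpow k
  g = geomInv k

ratio-plus-one : ∀ k → 1 ℕ.≤ k → ratio k ⊕ 1ₛ ≈ 2ₛ ⊗ geomInv k
ratio-plus-one k 1≤k = begin
  ratio k ⊕ 1ₛ                                              ≈⟨ ⊕-cong (ratio≈ k) (SR.sym (1-q^k-inverse k 1≤k)) ⟩
  ((1ₛ ⊕ x) ⊗ g) ⊕ ((1ₛ ⊕ negS x) ⊗ g)                      ≈⟨ solve 2 (λ x g → (con (+ 1) :+ x) :* g :+ (con (+ 1) :- x) :* g
                                                                              := con (+ 2) :* g) SR.refl x g ⟩
  2ₛ ⊗ g                                                    ∎
  where
  open SeriesSolver
  open ≈-Reasoning
  x = qpow k
  g = geomInv k

-- With a = ratio j and b = ratio (j + k): since a = (1 + x)/(1 - x) and b = (1 + x q^k)/(1 - x q^k) for x = q^j,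
-- (a + 1)(b - 1) = 4 x q^k / ((1 - x)(1 - x q^k)) = q^k (a - 1)(b + 1).
ratio-cross : ∀ j k → 1 ℕ.≤ j → 1 ℕ.≤ k →
  (ratio j ⊕ 1ₛ) ⊗ (ratio (j ℕ.+ k) ⊕ negS 1ₛ) ≈ qpow k ⊗ ((ratio j ⊕ negS 1ₛ) ⊗ (ratio (j ℕ.+ k) ⊕ 1ₛ))
ratio-cross j k 1≤j 1≤k = begin
  (ratio j ⊕ 1ₛ) ⊗ (ratio (j ℕ.+ k) ⊕ negS 1ₛ)
    ≈⟨ ⊗-cong (ratio-plus-one j 1≤j) (ratio-minus-one (j ℕ.+ k) 1≤j+k) ⟩
  (2ₛ ⊗ gj) ⊗ (2ₛ ⊗ (qpow (j ℕ.+ k) ⊗ gjk))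
    ≈⟨ ⊗-congʳ (2ₛ ⊗ gj) (⊗-congʳ 2ₛ (⊗-congˡ gjk (SR.sym (qpow-+ j k)))) ⟩
  (2ₛ ⊗ gj) ⊗ (2ₛ ⊗ ((x ⊗ z) ⊗ gjk))
    ≈⟨ solve 4 (λ x z gj gjk → (con (+ 2) :* gj) :* (con (+ 2) :* ((x :* z) :* gjk))
                            := z :* ((con (+ 2) :* (x :* gj)) :* (con (+ 2) :* gjk))) SR.refl x z gj gjk ⟩
  z ⊗ ((2ₛ ⊗ (x ⊗ gj)) ⊗ (2ₛ ⊗ gjk))
    ≈⟨ ⊗-congʳ z (⊗-cong (ratio-minus-one j 1≤j) (ratio-plus-one (j ℕ.+ k) 1≤j+k)) ⟨
  qpow k ⊗ ((ratio j ⊕ negS 1ₛ) ⊗ (ratio (j ℕ.+ k) ⊕ 1ₛ))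
    ∎
  where
  open SeriesSolver
  open ≈-Reasoning
  x = qpow j
  z = qpow k
  gj = geomInv j
  gjk = geomInv (j ℕ.+ k)
  1≤j+k : 1 ℕ.≤ j ℕ.+ k
  1≤j+k = ℕ.≤-trans 1≤j (ℕ.m≤m+n j k)

window : ℕ → ℕ → Series
window l zero    = oneS
window l (suc c) = window l c ⊗ ratio (suc (l ℕ.+ c))

window-shift : ∀ l c → window l (suc c) ≈ ratio (suc l) ⊗ window (suc l) c
window-shift l zero = begin
  oneS ⊗ ratio (suc (l ℕ.+ 0))      ≈⟨ ⊗-identityˡ (ratio (suc (l ℕ.+ 0))) ⟩
  ratio (suc (l ℕ.+ 0))             ≡⟨ cong (ratio ∘ suc) (ℕ.+-identityʳ l) ⟩
  ratio (suc l)                     ≈⟨ SR.*-identityʳ (ratio (suc l)) ⟨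
  ratio (suc l) ⊗ oneS              ∎
  where open ≈-Reasoning
window-shift l (suc c) = begin
  window l (suc c) ⊗ ratio (suc (l ℕ.+ suc c))
    ≈⟨ ⊗-congˡ (ratio (suc (l ℕ.+ suc c))) (window-shift l c) ⟩
  (ratio (suc l) ⊗ window (suc l) c) ⊗ ratio (suc (l ℕ.+ suc c))
    ≡⟨ cong (λ n → (ratio (suc l) ⊗ window (suc l) c) ⊗ ratio (suc n)) (ℕ.+-suc l c) ⟩
  (ratio (suc l) ⊗ window (suc l) c) ⊗ ratio (suc (suc l ℕ.+ c))
    ≈⟨ ⊗-assoc (ratio (suc l)) (window (suc l) c) (ratio (suc (suc l ℕ.+ c))) ⟩
  ratio (suc l) ⊗ window (suc l) (suc c)
    ∎
  where open ≈-Reasoning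

window-≤ : ∀ l c i → i ℕ.≤ l → window l c i ≡ oneS i
window-≤ l zero    i i≤l = refl
window-≤ l (suc c) i i≤l = trans
  (⊗-congUpTo i (λ j j≤i → window-≤ l c j (ℕ.≤-trans j≤i i≤l))
                (λ j j≤i → ratio-< (suc (l ℕ.+ c)) j (s≤s (ℕ.≤-trans (ℕ.≤-trans j≤i i≤l) (ℕ.m≤m+n l c)))))
  (⊗-identityˡ oneS .coeff i)

negQPoch⊗invQPoch : ∀ t → negQPoch t ⊗ invQPoch t ≈ window 0 t
negQPoch⊗invQPoch zero    = ⊗-identityˡ oneS
negQPoch⊗invQPoch (suc t) = begin
  (negQPoch t ⊗ (oneS ⊕ qpow (suc t))) ⊗ (invQPoch t ⊗ geomInv (suc t))
    ≈⟨ solve 4 (λ N q I g → (N :* q) :* (I :* g) := (N :* I) :* (q :* g)) SR.refl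
               (negQPoch t) (oneS ⊕ qpow (suc t)) (invQPoch t) (geomInv (suc t)) ⟩
  (negQPoch t ⊗ invQPoch t) ⊗ ratio (suc t)
    ≈⟨ ⊗-congˡ (ratio (suc t)) (negQPoch⊗invQPoch t) ⟩
  window 0 t ⊗ ratio (suc t)
    ∎
  where
  open SeriesSolver
  open ≈-Reasoning

-- Overpartitions with smallest part l + 1 and largest part at most l + 1 + t.
windowDiff : ℕ → ℕ → Series
windowDiff t l = window l (suc t) ⊕ negS (window (suc l) t)

-- With A = W(l + 1, t), a = ratio (l + 1) and b = ratio (l + t + 2), the left side is A (a - 1)(b + 1); the right side is
-- 2 A (a - b)/(1 - q^{t+1}), and (a - 1)(b + 1)(1 - q^{t+1}) = 2 (a - b) by ratio-cross.
windowDiff-recurrence : ∀ t l →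
  windowDiff (suc t) l ⊕ windowDiff t l ≈ 2ₛ ⊗ (geomInv (suc t) ⊗ (window l (suc t) ⊕ negS (window (suc l) (suc t))))
windowDiff-recurrence t l = begin
  windowDiff (suc t) l ⊕ windowDiff t l
    ≈⟨ ⊕-cong (⊕-congˡ (negS (A ⊗ b)) (window-shift l (suc t))) (⊕-congˡ (negS A) (window-shift l t)) ⟩
  ((a ⊗ (A ⊗ b)) ⊕ negS (A ⊗ b)) ⊕ ((a ⊗ A) ⊕ negS A)
    ≈⟨ solve 3 (λ A a b → (a :* (A :* b) :- A :* b) :+ (a :* A :- A)
                       := (A :* ((a :- con (+ 1)) :* (b :+ con (+ 1)))) :* con (+ 1)) SR.refl A a b ⟩
  (A ⊗ ((a ⊕ negS 1ₛ) ⊗ (b ⊕ 1ₛ))) ⊗ 1ₛ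
    ≈⟨ ⊗-congʳ (A ⊗ ((a ⊕ negS 1ₛ) ⊗ (b ⊕ 1ₛ))) (1-q^k-inverse (suc t) (s≤s z≤n)) ⟨
  (A ⊗ ((a ⊕ negS 1ₛ) ⊗ (b ⊕ 1ₛ))) ⊗ ((1ₛ ⊕ negS z) ⊗ g)
    ≈⟨ solve 5 (λ A a b z g → (A :* ((a :- con (+ 1)) :* (b :+ con (+ 1)))) :* ((con (+ 1) :- z) :* g)
                           := (g :* A) :* ((a :- con (+ 1)) :* (b :+ con (+ 1)) :- z :* ((a :- con (+ 1)) :* (b :+ con (+ 1)))))
               SR.refl A a b z g ⟩
  (g ⊗ A) ⊗ (((a ⊕ negS 1ₛ) ⊗ (b ⊕ 1ₛ)) ⊕ negS (z ⊗ ((a ⊕ negS 1ₛ) ⊗ (b ⊕ 1ₛ))))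
    ≈⟨ ⊗-congʳ (g ⊗ A) (⊕-congʳ ((a ⊕ negS 1ₛ) ⊗ (b ⊕ 1ₛ)) (negS-cong cross)) ⟨
  (g ⊗ A) ⊗ (((a ⊕ negS 1ₛ) ⊗ (b ⊕ 1ₛ)) ⊕ negS ((a ⊕ 1ₛ) ⊗ (b ⊕ negS 1ₛ)))
    ≈⟨ solve 4 (λ A a b g → (g :* A) :* ((a :- con (+ 1)) :* (b :+ con (+ 1)) :- (a :+ con (+ 1)) :* (b :- con (+ 1)))
                         := con (+ 2) :* (g :* (a :* A :- A :* b))) SR.refl A a b g ⟩
  2ₛ ⊗ (g ⊗ ((a ⊗ A) ⊕ negS (A ⊗ b)))
    ≈⟨ ⊗-congʳ 2ₛ (⊗-congʳ g (⊕-congˡ (negS (A ⊗ b)) (window-shift l t))) ⟨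
  2ₛ ⊗ (g ⊗ (window l (suc t) ⊕ negS (window (suc l) (suc t))))
    ∎
  where
  open SeriesSolver
  open ≈-Reasoning
  A = window (suc l) t
  a = ratio (suc l)
  b = ratio (suc (suc l ℕ.+ t))
  z = qpow (suc t)
  g = geomInv (suc t)
  cross : (a ⊕ 1ₛ) ⊗ (b ⊕ negS 1ₛ) ≈ z ⊗ ((a ⊕ negS 1ₛ) ⊗ (b ⊕ 1ₛ))
  cross = subst (λ n → (a ⊕ 1ₛ) ⊗ (ratio n ⊕ negS 1ₛ) ≈ z ⊗ ((a ⊕ negS 1ₛ) ⊗ (ratio n ⊕ 1ₛ)))
                (ℕ.+-suc (suc l) t) (ratio-cross (suc l) (suc t) (s≤s z≤n) (s≤s z≤n))

-- If F = U + q^k F, then U + 2 q^k F = (1 + q^k) F = U (1 + q^k)/(1 - q^k).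
ratio-recurrence : ∀ k → 1 ℕ.≤ k → ∀ U F → F ≈ U ⊕ scale (+ 1) (qpow k ⊗ F) →
                   U ⊕ scale (+ 2) (qpow k ⊗ F) ≈ U ⊗ ratio k
ratio-recurrence k 1≤k U F F≈ = begin
  U ⊕ scale (+ 2) (x ⊗ F)
    ≈⟨ ⊕-congʳ U (constS-⊗ (+ 2) (x ⊗ F)) ⟨
  U ⊕ (2ₛ ⊗ (x ⊗ F))
    ≈⟨ solve 3 (λ U x F → U :+ con (+ 2) :* (x :* F) := (U :+ con (+ 1) :* (x :* F)) :+ x :* F) SR.refl U x F ⟩
  (U ⊕ (1ₛ ⊗ (x ⊗ F))) ⊕ (x ⊗ F)
    ≈⟨ ⊕-congˡ (x ⊗ F) (SR.sym F≈′) ⟩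
  F ⊕ (x ⊗ F)
    ≈⟨ solve 2 (λ x F → F :+ x :* F := ((con (+ 1) :+ x) :* F) :* con (+ 1)) SR.refl x F ⟩
  ((1ₛ ⊕ x) ⊗ F) ⊗ 1ₛ
    ≈⟨ ⊗-congʳ ((1ₛ ⊕ x) ⊗ F) (1-q^k-inverse k 1≤k) ⟨
  ((1ₛ ⊕ x) ⊗ F) ⊗ ((1ₛ ⊕ negS x) ⊗ g)
    ≈⟨ solve 3 (λ x F g → ((con (+ 1) :+ x) :* F) :* ((con (+ 1) :- x) :* g) := ((con (+ 1) :- x) :* F) :* ((con (+ 1) :+ x) :* g)) SR.refl x F g ⟩
  ((1ₛ ⊕ negS x) ⊗ F) ⊗ ((1ₛ ⊕ x) ⊗ g)
    ≈⟨ ⊗-cong U≈ (SR.sym (ratio≈ k)) ⟩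
  U ⊗ ratio k
    ∎
  where
  open SeriesSolver
  open ≈-Reasoning
  x = qpow k
  g = geomInv k
  F≈′ : F ≈ U ⊕ (1ₛ ⊗ (x ⊗ F))
  F≈′ = SR.trans F≈ (⊕-congʳ U (SR.sym (constS-⊗ (+ 1) (x ⊗ F))))
  U≈ : (1ₛ ⊕ negS x) ⊗ F ≈ U
  U≈ = begin
    (1ₛ ⊕ negS x) ⊗ F                                ≈⟨ solve 2 (λ x F → (con (+ 1) :- x) :* F := F :- con (+ 1) :* (x :* F)) SR.refl x F ⟩
    F ⊕ negS (1ₛ ⊗ (x ⊗ F))                          ≈⟨ ⊕-congˡ (negS (1ₛ ⊗ (x ⊗ F))) F≈′ ⟩
    (U ⊕ (1ₛ ⊗ (x ⊗ F))) ⊕ negS (1ₛ ⊗ (x ⊗ F))       ≈⟨ solve 2 (λ U y → (U :+ y) :- y := U) SR.refl U (1ₛ ⊗ (x ⊗ F)) ⟩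
    U                                                ∎

∑-telescope : ∀ n (f : ℕ → ℤ) → ∑ n (λ l → f l - f (suc l)) ≡ f 0 - f n
∑-telescope zero    f = sym (ℤ.+-inverseʳ (f 0))
∑-telescope (suc n) f = begin
  f 0 - f 1 + ∑ n (λ l → f (suc l) - f (suc (suc l)))    ≡⟨ cong (_+_ (f 0 - f 1)) (∑-telescope n (f ∘ suc)) ⟩
  f 0 - f 1 + (f 1 - f (suc n))                           ≡⟨ cancel (f 0) (f 1) (f (suc n)) ⟩
  f 0 - f (suc n)                                         ∎
  where
  open ≡-Reasoning
  cancel : ∀ a b c → a - b + (b - c) ≡ a - c
  cancel = solve-∀

⊗-⊖ : ∀ Y P Q m → (Y ⊗ (P ⊕ negS Q)) m ≡ (Y ⊗ P) m - (Y ⊗ Q) m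
⊗-⊖ Y P Q = (solve 3 (λ Y P Q → Y :* (P :- Q) := Y :* P :- Y :* Q) SR.refl Y P Q) .coeff
  where open SeriesSolver

-- The coefficient of q^m in D_t; no overpartition of m has a smallest part above m.
windowSum : ℕ → ℕ → ℤ
windowSum t m = ∑ m (λ l → windowDiff t l m)

-- The sum over l telescopes, and W(m, t + 1) agrees with 1 up to degree m.
windowSum-recurrence : ∀ t m →
  windowSum (suc t) m + windowSum t m ≡ + 2 * (geomInv (suc t) ⊗ ((negQPoch (suc t) ⊗ invQPoch (suc t)) ⊖ oneS)) m
windowSum-recurrence t m = begin
  windowSum (suc t) m + windowSum t m
    ≡⟨ ∑-+ m (λ l → windowDiff (suc t) l m) (λ l → windowDiff t l m) ⟨
  ∑ m (λ l → (windowDiff (suc t) l ⊕ windowDiff t l) m)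
    ≡⟨ ∑-cong m (λ l → trans (windowDiff-recurrence t l .coeff m)
                             (constS-⊗ (+ 2) (g ⊗ (window l (suc t) ⊕ negS (window (suc l) (suc t)))) .coeff m)) ⟩
  ∑ m (λ l → + 2 * (g ⊗ (window l (suc t) ⊕ negS (window (suc l) (suc t)))) m)
    ≡⟨ ∑-*ˡ m (+ 2) (λ l → (g ⊗ (window l (suc t) ⊕ negS (window (suc l) (suc t)))) m) ⟩
  + 2 * ∑ m (λ l → (g ⊗ (window l (suc t) ⊕ negS (window (suc l) (suc t)))) m)
    ≡⟨ cong (+ 2 *_) (trans (∑-cong m (λ l → ⊗-⊖ g (window l (suc t)) (window (suc l) (suc t)) m))
                            (∑-telescope m (λ l → (g ⊗ window l (suc t)) m))) ⟩
  + 2 * ((g ⊗ window 0 (suc t)) m - (g ⊗ window m (suc t)) m)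
    ≡⟨ cong (+ 2 *_) (sym (⊗-⊖ g (window 0 (suc t)) (window m (suc t)) m)) ⟩
  + 2 * (g ⊗ (window 0 (suc t) ⊕ negS (window m (suc t)))) m
    ≡⟨ cong (+ 2 *_) (⊗-congUpTo {g} {g} {(negQPoch (suc t) ⊗ invQPoch (suc t)) ⊖ oneS} m (λ _ _ → refl) (λ i i≤m →
         cong₂ _-_ (negQPoch⊗invQPoch (suc t) .coeff i) (sym (window-≤ m (suc t) i i≤m)))) ⟨
  + 2 * (g ⊗ ((negQPoch (suc t) ⊗ invQPoch (suc t)) ⊖ oneS)) m
    ∎
  where
  open ≡-Reasoning
  g = geomInv (suc t)

count-filter : ∀ {A : Set} {P : A → Set} (P? : Decidable P) xs →
               + length (filter P? xs) ≡ sumℤ (map (λ x → 𝟙 (does (P? x))) xs)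
count-filter P? []       = refl
count-filter P? (x ∷ xs) with does (P? x)
... | true  = cong (_+_ (+ 1)) (count-filter P? xs)
... | false = trans (count-filter P? xs) (sym (ℤ.+-identityˡ _))

d-as-sum : ∀ m → + d m ≡ ∑ m (λ l → 𝟙 (does (suc l ∣? m)))
d-as-sum m = begin
  + d m                                                       ≡⟨ count-filter (_∣? m) (map suc (upTo m)) ⟩
  sumℤ (map (λ k → 𝟙 (does (k ∣? m))) (map suc (upTo m)))    ≡⟨ cong sumℤ (List.map-∘ (upTo m)) ⟨
  sumℤ (map (λ l → 𝟙 (does (suc l ∣? m))) (upTo m))          ≡⟨ sumℤ-map-upTo _ m ⟩
  ∑ m (λ l → 𝟙 (does (suc l ∣? m)))                          ∎
  where open ≡-Reasoning

windowSum-zero : ∀ m → windowSum 0 m ≡ rhs 0 m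
windowSum-zero zero    = refl
windowSum-zero (suc n) = begin
  ∑ (suc n) (λ l → windowDiff 0 l (suc n))
    ≡⟨ ∑-cong (suc n) (λ l → trans (ℤ.+-identityʳ _) (trans (⊗-identityˡ (ratio (suc (l ℕ.+ 0))) .coeff (suc n))
                                    (cong (λ k → ratio (suc k) (suc n)) (ℕ.+-identityʳ l)))) ⟩
  ∑ (suc n) (λ l → ratio (suc l) (suc n))
    ≡⟨ ∑-cong (suc n) (λ l → ratio-coeff (suc l) (suc n) (s≤s z≤n)) ⟩
  ∑ (suc n) (λ l → + 2 * 𝟙 (does (suc l ∣? suc n)))
    ≡⟨ ∑-*ˡ (suc n) (+ 2) (λ l → 𝟙 (does (suc l ∣? suc n))) ⟩
  + 2 * ∑ (suc n) (λ l → 𝟙 (does (suc l ∣? suc n)))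
    ≡⟨ cong (+ 2 *_) (trans (sym (d-as-sum (suc n))) (sym (ℤ.+-identityʳ _))) ⟩
  rhs 0 (suc n)
    ∎
  where open ≡-Reasoning

-1^t-squared : ∀ t → (- + 1) ℤ.^ t * (- + 1) ℤ.^ t ≡ + 1
-1^t-squared zero    = refl
-1^t-squared (suc t) = trans (swap-signs ((- + 1) ℤ.^ t)) (-1^t-squared t)
  where
  swap-signs : ∀ u → (- + 1 * u) * (- + 1 * u) ≡ u * u
  swap-signs = solve-∀

windowSum≡rhs : ∀ t m → windowSum t m ≡ rhs t m
windowSum≡rhs zero    m = windowSum-zero m
windowSum≡rhs (suc t) m = begin
  windowSum (suc t) m                                 ≡⟨ add-sub (windowSum (suc t) m) (windowSum t m) ⟩
  (windowSum (suc t) m + windowSum t m) - windowSum t m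
                                                      ≡⟨ cong₂ _-_ (windowSum-recurrence t m) (windowSum≡rhs t m) ⟩
  + 2 * X - (+ 2 * u) * (D + S)                       ≡⟨ cong (λ v → + 2 * v - (+ 2 * u) * (D + S))
                                                              (trans (cong (_* X) (-1^t-squared t)) (ℤ.*-identityˡ X)) ⟨
  + 2 * ((u * u) * X) - (+ 2 * u) * (D + S)           ≡⟨ regroup u X D S ⟩
  rhs (suc t) m                                       ∎
  where
  open ≡-Reasoning
  u = (- + 1) ℤ.^ t
  X = (geomInv (suc t) ⊗ ((negQPoch (suc t) ⊗ invQPoch (suc t)) ⊖ oneS)) m
  D = dSeries m
  S = sumS term t m
  add-sub : ∀ a b → a ≡ (a + b) - b
  add-sub = solve-∀
  regroup : ∀ u X D S → + 2 * ((u * u) * X) - (+ 2 * u) * (D + S) ≡ (+ 2 * (- + 1 * u)) * (D + (S + (- + 1 * u) * X))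
  regroup = solve-∀

count : (List Entry → Bool) → List (List Entry) → ℤ
count P ws = sumℤ (map (𝟙 ∘ P) ws)

sumℤ-++ : ∀ xs ys → sumℤ (xs ++ ys) ≡ sumℤ xs + sumℤ ys
sumℤ-++ []       ys = sym (ℤ.+-identityˡ _)
sumℤ-++ (x ∷ xs) ys = trans (cong (_+_ x) (sumℤ-++ xs ys)) (sym (ℤ.+-assoc x _ _))

sumℤ-map-concatMap : ∀ {A B : Set} (h : B → ℤ) (g : A → List B) as →
                     sumℤ (map h (concatMap g as)) ≡ sumℤ (map (λ a → sumℤ (map h (g a))) as)
sumℤ-map-concatMap h g []       = refl
sumℤ-map-concatMap h g (a ∷ as) = begin
  sumℤ (map h (g a ++ concatMap g as))                 ≡⟨ cong sumℤ (List.map-++ h (g a) (concatMap g as)) ⟩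
  sumℤ (map h (g a) ++ map h (concatMap g as))         ≡⟨ sumℤ-++ (map h (g a)) _ ⟩
  sumℤ (map h (g a)) + sumℤ (map h (concatMap g as))   ≡⟨ cong (_+_ (sumℤ (map h (g a)))) (sumℤ-map-concatMap h g as) ⟩
  sumℤ (map h (g a)) + sumℤ (map (λ a → sumℤ (map h (g a))) as) ∎
  where open ≡-Reasoning

count-cong : ∀ {P Q} → (∀ xs → P xs ≡ Q xs) → ∀ ws → count P ws ≡ count Q ws
count-cong eq ws = cong sumℤ (List.map-cong (cong 𝟙 ∘ eq) ws)

count-∧ : ∀ c P ws → count (λ xs → c ∧ P xs) ws ≡ 𝟙 c * count P ws
count-∧ true  P ws       = sym (ℤ.*-identityˡ _)
count-∧ false P []       = refl
count-∧ false P (w ∷ ws) = trans (ℤ.+-identityˡ _) (count-∧ false P ws)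

count-wordsOfLength-suc : ∀ P k es →
  count P (wordsOfLength (suc k) es) ≡ sumℤ (map (λ e → count (P ∘ (e ∷_)) (wordsOfLength k es)) es)
count-wordsOfLength-suc P k es =
  trans (sumℤ-map-concatMap (𝟙 ∘ P) (λ e → map (e ∷_) (wordsOfLength k es)) es)
        (cong sumℤ (List.map-cong (λ e → cong sumℤ (sym (List.map-∘ (wordsOfLength k es)))) es))

sumℤ-map-entries : ∀ (h : Entry → ℤ) n → sumℤ (map h (entries n)) ≡ ∑ (suc n) (λ b → h (b , false) + h (b , true))
sumℤ-map-entries h n = begin
  sumℤ (map h (entries n))
    ≡⟨ sumℤ-map-concatMap h (λ b → (b , false) ∷ (b , true) ∷ []) (upTo (suc n)) ⟩
  sumℤ (map (λ b → h (b , false) + (h (b , true) + + 0)) (upTo (suc n)))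
    ≡⟨ sumℤ-map-upTo (λ b → h (b , false) + (h (b , true) + + 0)) (suc n) ⟩
  ∑ (suc n) (λ b → h (b , false) + (h (b , true) + + 0))
    ≡⟨ ∑-cong (suc n) (λ b → cong (_+_ (h (b , false))) (ℤ.+-identityʳ (h (b , true)))) ⟩
  ∑ (suc n) (λ b → h (b , false) + h (b , true))
    ∎
  where open ≡-Reasoning

count-candidates : ∀ P n → count P (candidates n) ≡ ∑ (suc n) (λ k → count P (wordsOfLength k (entries n)))
count-candidates P n = trans (sumℤ-map-concatMap (𝟙 ∘ P) (λ k → wordsOfLength k (entries n)) (upTo (suc n)))
                             (sumℤ-map-upTo (λ k → count P (wordsOfLength k (entries n))) (suc n))

-- Overpartitions with all parts above l, built part by part

partsWithin : ℕ → ℕ → List Entry → Bool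
partsWithin lo hi []             = true
partsWithin lo hi ((b , _) ∷ xs) = (⌊ lo ℕ.≤? b ⌋ ∧ ⌊ b ℕ.≤? hi ⌋) ∧ partsWithin lo hi xs

-- okPair ignores the overline of the earlier entry, so only the preceding part a matters.
okHead : ℕ → List Entry → Bool
okHead a []      = true
okHead a (y ∷ _) = okPair (a , false) y

sorted-∷ : ∀ b o ys → sorted ((b , o) ∷ ys) ≡ okHead b ys ∧ sorted ys
sorted-∷ b o []                 = refl
sorted-∷ b o ((c , false) ∷ ys) = refl
sorted-∷ b o ((c , true)  ∷ ys) = refl

≟-+-split : ∀ b s m → ⌊ b ℕ.+ s ℕ.≟ m ⌋ ≡ ⌊ b ℕ.≤? m ⌋ ∧ ⌊ s ℕ.≟ m ∸ b ⌋
≟-+-split b s m = ⌊⌋-∧ (b ℕ.≤? m) (s ℕ.≟ m ∸ b) (b ℕ.+ s ℕ.≟ m)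
  (λ b+s≡m → subst (b ℕ.≤_) b+s≡m (ℕ.m≤m+n b s) , trans (sym (ℕ.m+n∸m≡n b s)) (cong (_∸ b) b+s≡m))
  (λ b≤m s≡m∸b → trans (cong (b ℕ.+_) s≡m∸b) (ℕ.m+[n∸m]≡n b≤m))

okPair-≤ : ∀ a b o → okPair (a , false) (b , o) ≡ true → b ℕ.≤ a
okPair-≤ a b false eq = toWitness (subst T (sym eq) tt)
okPair-≤ a b true  eq = ℕ.<⇒≤ (toWitness (subst T (sym eq) tt))

∸-suc-≤ : ∀ m b {K} → m ℕ.≤ suc K → m ∸ suc b ℕ.≤ K
∸-suc-≤ zero    b _         = z≤n
∸-suc-≤ (suc m) b (s≤s m≤K) = ℕ.≤-trans (ℕ.m∸n≤m m b) m≤K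

module PartsAbove (l : ℕ) where

  follows : ℕ → Entry → Bool
  follows a (b , o) = ⌊ l ℕ.<? b ⌋ ∧ okPair (a , false) (b , o)

  inWindow : ℕ → Entry → Bool
  inWindow c (b , _) = ⌊ l ℕ.<? b ⌋ ∧ ⌊ b ℕ.≤? l ℕ.+ c ⌋

  fits : (Entry → Bool) → ℕ → List Entry → Bool
  fits h m []             = ⌊ 0 ℕ.≟ m ⌋
  fits h m ((b , o) ∷ xs) = h (b , o) ∧ (⌊ b ℕ.≤? m ⌋ ∧ fits (follows b) (m ∸ b) xs)

  weight : (Entry → Bool) → ℕ → ℤ
  weight h b = 𝟙 (h (b , false)) + 𝟙 (h (b , true))

  -- The number of lists of length at most K that fit h and m.
  fitCount : ℕ → (Entry → Bool) → ℕ → ℤ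
  fitCount zero    h m = oneS m
  fitCount (suc K) h m = oneS m + ∑ (suc m) (λ b → weight h b * fitCount K (follows b) (m ∸ b))

  fitSeries : (Entry → Bool) → Series
  fitSeries h m = fitCount m h m

  count-empty : ∀ h m → count (fits h m) ([] ∷ []) ≡ oneS m
  count-empty h zero    = refl
  count-empty h (suc m) = refl

  weightUpTo : (Entry → Bool) → ℕ → ℕ → ℤ
  weightUpTo h m b = 𝟙 (h (b , false) ∧ ⌊ b ℕ.≤? m ⌋) + 𝟙 (h (b , true) ∧ ⌊ b ℕ.≤? m ⌋)

  count-fits-∷ : ∀ h m k es → count (fits h m) (wordsOfLength (suc k) es) ≡
    sumℤ (map (λ e → 𝟙 (h e ∧ ⌊ proj₁ e ℕ.≤? m ⌋) * count (fits (follows (proj₁ e)) (m ∸ proj₁ e)) (wordsOfLength k es)) es)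
  count-fits-∷ h m k es = trans (count-wordsOfLength-suc (fits h m) k es)
    (cong sumℤ (List.map-cong (λ { (b , o) → first b o }) es))
    where
    first : ∀ b o → count (fits h m ∘ ((b , o) ∷_)) (wordsOfLength k es) ≡
                    𝟙 (h (b , o) ∧ ⌊ b ℕ.≤? m ⌋) * count (fits (follows b) (m ∸ b)) (wordsOfLength k es)
    first b o = trans (count-cong (λ xs → sym (∧-assoc (h (b , o)) ⌊ b ℕ.≤? m ⌋ (fits (follows b) (m ∸ b) xs))) (wordsOfLength k es))
                      (count-∧ (h (b , o) ∧ ⌊ b ℕ.≤? m ⌋) (fits (follows b) (m ∸ b)) (wordsOfLength k es))

  count-fits-entries : ∀ h m k n → count (fits h m) (wordsOfLength (suc k) (entries n)) ≡
    ∑ (suc n) (λ b → weightUpTo h m b * count (fits (follows b) (m ∸ b)) (wordsOfLength k (entries n)))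
  count-fits-entries h m k n = trans (count-fits-∷ h m k (entries n))
    (trans (sumℤ-map-entries (λ e → 𝟙 (h e ∧ ⌊ proj₁ e ℕ.≤? m ⌋) * C (proj₁ e)) n)
           (∑-cong (suc n) (λ b → sym (ℤ.*-distribʳ-+ (C b) (𝟙 (h (b , false) ∧ ⌊ b ℕ.≤? m ⌋))
                                                             (𝟙 (h (b , true) ∧ ⌊ b ℕ.≤? m ⌋))))))
    where
    C : ℕ → ℤ
    C b = count (fits (follows b) (m ∸ b)) (wordsOfLength k (entries n))

  ∑-weightUpTo : ∀ h m n (X : ℕ → ℤ) → m ℕ.≤ n →
                 ∑ (suc n) (λ b → weightUpTo h m b * X b) ≡ ∑ (suc m) (λ b → weight h b * X b)
  ∑-weightUpTo h m n X m≤n = begin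
    ∑ (suc n) (λ b → weightUpTo h m b * X b)                ≡⟨ cong (λ n′ → ∑ (suc n′) (λ b → weightUpTo h m b * X b)) (ℕ.m+[n∸m]≡n m≤n) ⟨
    ∑ (suc m ℕ.+ (n ∸ m)) (λ b → weightUpTo h m b * X b)    ≡⟨ ∑-extend (suc m) (n ∸ m) (λ b → weightUpTo h m b * X b)
                                                                  (λ b m<b → trans (cong (_* X b) (beyond b m<b)) (ℤ.*-zeroˡ (X b))) ⟩
    ∑ (suc m) (λ b → weightUpTo h m b * X b)                ≡⟨ ∑-cong< (suc m) (λ b b<1+m → cong (_* X b) (within b (ℕ.≤-pred b<1+m))) ⟩
    ∑ (suc m) (λ b → weight h b * X b)                      ∎
    where
    open ≡-Reasoning
    beyond : ∀ b → suc m ℕ.≤ b → weightUpTo h m b ≡ + 0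
    beyond b m<b rewrite ⌊⌋-false (b ℕ.≤? m) (ℕ.<⇒≱ m<b) | ∧-zeroʳ (h (b , false)) | ∧-zeroʳ (h (b , true)) = refl
    within : ∀ b → b ℕ.≤ m → weightUpTo h m b ≡ weight h b
    within b b≤m rewrite ⌊⌋-true (b ℕ.≤? m) b≤m | ∧-identityʳ (h (b , false)) | ∧-identityʳ (h (b , true)) = refl

  count-fits : ∀ n K h m → m ℕ.≤ n → ∑ (suc K) (λ k → count (fits h m) (wordsOfLength k (entries n))) ≡ fitCount K h m
  count-fits n zero    h m m≤n = trans (ℤ.+-identityʳ _) (count-empty h m)
  count-fits n (suc K) h m m≤n = cong₂ _+_ (count-empty h m) (begin
    ∑ (suc K) (λ k → count (fits h m) (W (suc k)))
      ≡⟨ ∑-cong (suc K) (λ k → count-fits-entries h m k n) ⟩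
    ∑ (suc K) (λ k → ∑ (suc n) (λ b → weightUpTo h m b * C b k))
      ≡⟨ ∑-swap (suc K) (suc n) (λ k b → weightUpTo h m b * C b k) ⟩
    ∑ (suc n) (λ b → ∑ (suc K) (λ k → weightUpTo h m b * C b k))
      ≡⟨ ∑-cong (suc n) (λ b → ∑-*ˡ (suc K) (weightUpTo h m b) (C b)) ⟩
    ∑ (suc n) (λ b → weightUpTo h m b * ∑ (suc K) (C b))
      ≡⟨ ∑-cong (suc n) (λ b → cong (weightUpTo h m b *_) (count-fits n K (follows b) (m ∸ b) (ℕ.≤-trans (ℕ.m∸n≤m m b) m≤n))) ⟩
    ∑ (suc n) (λ b → weightUpTo h m b * fitCount K (follows b) (m ∸ b))
      ≡⟨ ∑-weightUpTo h m n (λ b → fitCount K (follows b) (m ∸ b)) m≤n ⟩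
    ∑ (suc m) (λ b → weight h b * fitCount K (follows b) (m ∸ b))
      ∎)
    where
    open ≡-Reasoning
    W : ℕ → List (List Entry)
    W k = wordsOfLength k (entries n)
    C : ℕ → ℕ → ℤ
    C b k = count (fits (follows b) (m ∸ b)) (W k)

  -- Only parts b ≥ 1 contribute.
  fitCount-stable : ∀ K K′ a m → m ℕ.≤ K → m ℕ.≤ K′ → fitCount K (follows a) m ≡ fitCount K′ (follows a) m
  fitCount-stable zero    zero     a m       _ _ = refl
  fitCount-stable zero    (suc K′) a zero    _ _ = refl
  fitCount-stable (suc K) zero     a zero    _ _ = refl
  fitCount-stable (suc K) (suc K′) a m m≤1+K m≤1+K′ = cong (_+_ (oneS m)) (∑-cong (suc m) same)
    where
    same : ∀ b → weight (follows a) b * fitCount K (follows b) (m ∸ b) ≡ weight (follows a) b * fitCount K′ (follows b) (m ∸ b)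
    same zero    = refl
    same (suc b) = cong (weight (follows a) (suc b) *_)
      (fitCount-stable K K′ (suc b) (m ∸ suc b) (∸-suc-≤ m b m≤1+K) (∸-suc-≤ m b m≤1+K′))

  fitSeries-step : ∀ h h′ p c → 1 ℕ.≤ p → (∀ b → weight h′ b ≡ weight h b + c * qpow p b) →
                   fitSeries h′ ≈ fitSeries h ⊕ scale c (qpow p ⊗ fitSeries (follows p))
  fitSeries-step h h′ p c 1≤p weight-eq .coeff zero =
    sym (trans (cong (λ v → + 1 + c * v) (qpow-⊗-< p (fitSeries (follows p)) 0 1≤p)) (no-shift c))
    where
    no-shift : ∀ c → + 1 + c * + 0 ≡ + 1
    no-shift = solve-∀
  fitSeries-step h h′ p c 1≤p weight-eq .coeff (suc n) = begin
    + 0 + ∑ (suc (suc n)) (λ b → weight h′ b * X b)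
      ≡⟨ cong (_+_ (+ 0)) (∑-cong (suc (suc n)) (λ b → trans (cong (_* X b) (weight-eq b)) (split (weight h b) c (qpow p b) (X b)))) ⟩
    + 0 + ∑ (suc (suc n)) (λ b → weight h b * X b + c * (qpow p b * X b))
      ≡⟨ cong (_+_ (+ 0)) (∑-+ (suc (suc n)) (λ b → weight h b * X b) (λ b → c * (qpow p b * X b))) ⟩
    + 0 + (∑ (suc (suc n)) (λ b → weight h b * X b) + ∑ (suc (suc n)) (λ b → c * (qpow p b * X b)))
      ≡⟨ sym (ℤ.+-assoc (+ 0) (∑ (suc (suc n)) (λ b → weight h b * X b)) (∑ (suc (suc n)) (λ b → c * (qpow p b * X b)))) ⟩
    fitSeries h (suc n) + ∑ (suc (suc n)) (λ b → c * (qpow p b * X b))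
      ≡⟨ cong (_+_ (fitSeries h (suc n))) (∑-*ˡ (suc (suc n)) c (λ b → qpow p b * X b)) ⟩
    fitSeries h (suc n) + c * ∑ (suc (suc n)) (λ b → qpow p b * X b)
      ≡⟨ cong (λ v → fitSeries h (suc n) + c * v) (trans (∑-cong (suc (suc n)) shifted) (sym (⊗-coeff (qpow p) F (suc n)))) ⟩
    fitSeries h (suc n) + c * (qpow p ⊗ F) (suc n)
      ∎
    where
    open ≡-Reasoning
    F : Series
    F = fitSeries (follows p)
    X : ℕ → ℤ
    X b = fitCount n (follows b) (suc n ∸ b)
    split : ∀ w c q x → (w + c * q) * x ≡ w * x + c * (q * x)
    split = solve-∀
    shifted : ∀ b → qpow p b * X b ≡ qpow p b * F (suc n ∸ b)
    shifted b with p ℕ.≟ b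
    ... | no  p≢b rewrite qpow-≢ p≢b = refl
    ... | yes refl = cong (qpow p p *_) (fitCount-stable n (suc n ∸ p) p (suc n ∸ p) (∸-pos-≤ p 1≤p) ℕ.≤-refl)
      where
      ∸-pos-≤ : ∀ p → 1 ℕ.≤ p → suc n ∸ p ℕ.≤ n
      ∸-pos-≤ (suc p′) _ = ∸-suc-≤ (suc n) p′ ℕ.≤-refl

  -- Admitting the part a = l + c + 1: after a part a it can only appear unmarked, at the head it can be marked or not.
  weight-follows : ∀ c b → weight (follows (suc (l ℕ.+ c))) b ≡ weight (inWindow c) b + + 1 * qpow (suc (l ℕ.+ c)) b
  weight-follows c b with ℕ.<-cmp b (suc (l ℕ.+ c))
  ... | tri< b<1+a _ _
    rewrite ⌊⌋-true (b ℕ.≤? suc (l ℕ.+ c)) (ℕ.<⇒≤ b<1+a) | ⌊⌋-true (b ℕ.<? suc (l ℕ.+ c)) b<1+a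
          | ⌊⌋-true (b ℕ.≤? l ℕ.+ c) (ℕ.≤-pred b<1+a) | qpow-≢ {suc (l ℕ.+ c)} {b} (λ eq → ℕ.<-irrefl (sym eq) b<1+a)
    = sym (ℤ.+-identityʳ _)
  ... | tri≈ _ refl _
    rewrite ⌊⌋-true (l ℕ.<? suc (l ℕ.+ c)) (s≤s (ℕ.m≤m+n l c)) | ⌊⌋-true (suc (l ℕ.+ c) ℕ.≤? suc (l ℕ.+ c)) ℕ.≤-refl
          | ⌊⌋-false (suc (l ℕ.+ c) ℕ.<? suc (l ℕ.+ c)) (ℕ.<-irrefl refl) | ⌊⌋-false (suc (l ℕ.+ c) ℕ.≤? l ℕ.+ c) (ℕ.<-irrefl refl)
          | dec-true (suc (l ℕ.+ c) ℕ.≟ suc (l ℕ.+ c)) refl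
    = refl
  ... | tri> _ _ 1+a<b
    rewrite ⌊⌋-false (b ℕ.≤? suc (l ℕ.+ c)) (ℕ.<⇒≱ 1+a<b) | ⌊⌋-false (b ℕ.<? suc (l ℕ.+ c)) (λ b<1+a → ℕ.<-asym b<1+a 1+a<b)
          | ⌊⌋-false (b ℕ.≤? l ℕ.+ c) (ℕ.<⇒≱ (ℕ.<-trans (ℕ.n<1+n _) 1+a<b)) | qpow-≢ {suc (l ℕ.+ c)} {b} (λ eq → ℕ.<-irrefl eq 1+a<b)
    = sym (ℤ.+-identityʳ _)

  weight-inWindow-suc : ∀ c b → weight (inWindow (suc c)) b ≡ weight (inWindow c) b + + 2 * qpow (suc (l ℕ.+ c)) b
  weight-inWindow-suc c b rewrite ℕ.+-suc l c with ℕ.<-cmp b (suc (l ℕ.+ c))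
  ... | tri< b<1+a _ _
    rewrite ⌊⌋-true (b ℕ.≤? suc (l ℕ.+ c)) (ℕ.<⇒≤ b<1+a) | ⌊⌋-true (b ℕ.≤? l ℕ.+ c) (ℕ.≤-pred b<1+a)
          | qpow-≢ {suc (l ℕ.+ c)} {b} (λ eq → ℕ.<-irrefl (sym eq) b<1+a)
    = sym (ℤ.+-identityʳ _)
  ... | tri≈ _ refl _
    rewrite ⌊⌋-true (l ℕ.<? suc (l ℕ.+ c)) (s≤s (ℕ.m≤m+n l c)) | ⌊⌋-true (suc (l ℕ.+ c) ℕ.≤? suc (l ℕ.+ c)) ℕ.≤-refl
          | ⌊⌋-false (suc (l ℕ.+ c) ℕ.≤? l ℕ.+ c) (ℕ.<-irrefl refl) | dec-true (suc (l ℕ.+ c) ℕ.≟ suc (l ℕ.+ c)) refl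
    = refl
  ... | tri> _ _ 1+a<b
    rewrite ⌊⌋-false (b ℕ.≤? suc (l ℕ.+ c)) (ℕ.<⇒≱ 1+a<b) | ⌊⌋-false (b ℕ.≤? l ℕ.+ c) (ℕ.<⇒≱ (ℕ.<-trans (ℕ.n<1+n _) 1+a<b))
          | qpow-≢ {suc (l ℕ.+ c)} {b} (λ eq → ℕ.<-irrefl eq 1+a<b)
    = sym (ℤ.+-identityʳ _)

  weight-inWindow-zero : ∀ b → weight (inWindow 0) b ≡ + 0
  weight-inWindow-zero b rewrite ℕ.+-identityʳ l with l ℕ.<? b
  ... | yes l<b rewrite ⌊⌋-false (b ℕ.≤? l) (ℕ.<⇒≱ l<b) = refl
  ... | no  _   = refl

  fitSeries-weightless : ∀ h → (∀ b → weight h b ≡ + 0) → fitSeries h ≈ oneS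
  fitSeries-weightless h weightless .coeff zero    = refl
  fitSeries-weightless h weightless .coeff (suc n) =
    cong (_+_ (+ 0)) (∑-zero (suc (suc n)) (λ b _ → trans (cong (_* X b) (weightless b)) (ℤ.*-zeroˡ (X b))))
    where
    X : ℕ → ℤ
    X b = fitCount n (follows b) (suc n ∸ b)

  fitSeries-inWindow : ∀ c → fitSeries (inWindow c) ≈ window l c
  fitSeries-inWindow zero    = fitSeries-weightless (inWindow 0) weight-inWindow-zero
  fitSeries-inWindow (suc c) = begin
    fitSeries (inWindow (suc c))
      ≈⟨ fitSeries-step (inWindow c) (inWindow (suc c)) (suc a) (+ 2) (s≤s z≤n) (weight-inWindow-suc c) ⟩
    fitSeries (inWindow c) ⊕ scale (+ 2) (qpow (suc a) ⊗ F)
      ≈⟨ ratio-recurrence (suc a) (s≤s z≤n) (fitSeries (inWindow c)) F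
           (fitSeries-step (inWindow c) (follows (suc a)) (suc a) (+ 1) (s≤s z≤n) (weight-follows c)) ⟩
    fitSeries (inWindow c) ⊗ ratio (suc a)
      ≈⟨ ⊗-congˡ (ratio (suc a)) (fitSeries-inWindow c) ⟩
    window l (suc c)
      ∎
    where
    open ≈-Reasoning
    a = l ℕ.+ c
    F = fitSeries (follows (suc a))

  fits-follows : ∀ c a m ys → a ℕ.≤ l ℕ.+ c → fits (follows a) m ys ≡ okHead a ys ∧ fits (inWindow c) m ys
  fits-follows c a m []             _ = refl
  fits-follows c a m ((b , o) ∷ ys) a≤l+c with okPair (a , false) (b , o) in eq
  ... | false = cong (_∧ (⌊ b ℕ.≤? m ⌋ ∧ fits (follows b) (m ∸ b) ys)) (∧-zeroʳ ⌊ l ℕ.<? b ⌋)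
  ... | true  rewrite ⌊⌋-true (b ℕ.≤? l ℕ.+ c) (ℕ.≤-trans (okPair-≤ a b o eq) a≤l+c) = refl

  fits-inWindow : ∀ c m xs → fits (inWindow c) m xs ≡ isOverpartitionOf m xs ∧ partsWithin (suc l) (l ℕ.+ c) xs
  fits-inWindow c m []             = sym (∧-identityʳ _)
  fits-inWindow c m ((b , o) ∷ xs) with b ℕ.≤? l ℕ.+ c
  ... | no  _ = trans (cong (_∧ (⌊ b ℕ.≤? m ⌋ ∧ fits (follows b) (m ∸ b) xs)) (∧-zeroʳ ⌊ l ℕ.<? b ⌋))
                      (sym (trans (cong (λ v → isOverpartitionOf m ((b , o) ∷ xs) ∧ (v ∧ partsWithin (suc l) (l ℕ.+ c) xs))
                                        (∧-zeroʳ ⌊ l ℕ.<? b ⌋))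
                                  (∧-zeroʳ (isOverpartitionOf m ((b , o) ∷ xs)))))
  ... | yes b≤l+c with l ℕ.<? b
  ...   | no  _   = sym (∧-zeroʳ (isOverpartitionOf m ((b , o) ∷ xs)))
  ...   | yes l<b = begin
    ⌊ b ℕ.≤? m ⌋ ∧ fits (follows b) (m ∸ b) xs
      ≡⟨ cong (⌊ b ℕ.≤? m ⌋ ∧_) (trans (fits-follows c b (m ∸ b) xs b≤l+c) (cong (okHead b xs ∧_) (fits-inWindow c (m ∸ b) xs))) ⟩
    ⌊ b ℕ.≤? m ⌋ ∧ (okHead b xs ∧ ((allPositive xs ∧ (sorted xs ∧ ⌊ partSum xs ℕ.≟ m ∸ b ⌋)) ∧ partsWithin (suc l) (l ℕ.+ c) xs))
      ≡⟨ ∧-shuffle ⌊ b ℕ.≤? m ⌋ (okHead b xs) (allPositive xs) (sorted xs) ⌊ partSum xs ℕ.≟ m ∸ b ⌋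
                   (partsWithin (suc l) (l ℕ.+ c) xs) ⟩
    (allPositive xs ∧ ((okHead b xs ∧ sorted xs) ∧ (⌊ b ℕ.≤? m ⌋ ∧ ⌊ partSum xs ℕ.≟ m ∸ b ⌋))) ∧ partsWithin (suc l) (l ℕ.+ c) xs
      ≡⟨ cong₂ (λ s e → (allPositive xs ∧ (s ∧ e)) ∧ partsWithin (suc l) (l ℕ.+ c) xs)
               (sorted-∷ b o xs) (≟-+-split b (partSum xs) m) ⟨
    (allPositive xs ∧ (sorted ((b , o) ∷ xs) ∧ ⌊ b ℕ.+ partSum xs ℕ.≟ m ⌋)) ∧ partsWithin (suc l) (l ℕ.+ c) xs
      ≡⟨ cong (λ p → ((p ∧ allPositive xs) ∧ (sorted ((b , o) ∷ xs) ∧ ⌊ b ℕ.+ partSum xs ℕ.≟ m ⌋)) ∧ partsWithin (suc l) (l ℕ.+ c) xs)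
              (⌊⌋-true (1 ℕ.≤? b) (ℕ.≤-trans (s≤s z≤n) l<b)) ⟨
    ((⌊ 1 ℕ.≤? b ⌋ ∧ allPositive xs) ∧ (sorted ((b , o) ∷ xs) ∧ ⌊ b ℕ.+ partSum xs ℕ.≟ m ⌋)) ∧ partsWithin (suc l) (l ℕ.+ c) xs
      ∎
    where
    open ≡-Reasoning
    ∧-shuffle : ∀ B K P S E W → B ∧ (K ∧ ((P ∧ (S ∧ E)) ∧ W)) ≡ (P ∧ ((K ∧ S) ∧ (B ∧ E))) ∧ W
    ∧-shuffle = solve 6 (λ B K P S E W → B :* (K :* ((P :* (S :* E)) :* W)) := (P :* ((K :* S) :* (B :* E))) :* W) refl
      where open ∨-∧-Solver

-- Counting by smallest part

partsWithin-bounds : ∀ lo hi b o ys →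
  partsWithin lo hi ((b , o) ∷ ys) ≡ ⌊ lo ℕ.≤? smallestPart ((b , o) ∷ ys) ⌋ ∧ ⌊ largestPart ((b , o) ∷ ys) ℕ.≤? hi ⌋
partsWithin-bounds lo hi b o [] rewrite ℕ.⊔-identityʳ b = ∧-identityʳ _
partsWithin-bounds lo hi b o ((c , f) ∷ ys) = begin
  (⌊ lo ℕ.≤? b ⌋ ∧ ⌊ b ℕ.≤? hi ⌋) ∧ partsWithin lo hi ((c , f) ∷ ys)
    ≡⟨ cong (_∧_ (⌊ lo ℕ.≤? b ⌋ ∧ ⌊ b ℕ.≤? hi ⌋)) (partsWithin-bounds lo hi c f ys) ⟩
  (⌊ lo ℕ.≤? b ⌋ ∧ ⌊ b ℕ.≤? hi ⌋) ∧ (⌊ lo ℕ.≤? μ ⌋ ∧ ⌊ M ℕ.≤? hi ⌋)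
    ≡⟨ ∧-interchange ⌊ lo ℕ.≤? b ⌋ ⌊ b ℕ.≤? hi ⌋ ⌊ lo ℕ.≤? μ ⌋ ⌊ M ℕ.≤? hi ⌋ ⟩
  (⌊ lo ℕ.≤? b ⌋ ∧ ⌊ lo ℕ.≤? μ ⌋) ∧ (⌊ b ℕ.≤? hi ⌋ ∧ ⌊ M ℕ.≤? hi ⌋)
    ≡⟨ cong₂ _∧_ (⌊⌋-∧ (lo ℕ.≤? b) (lo ℕ.≤? μ) (lo ℕ.≤? b ⊓ μ)
                       (λ lo≤ → ℕ.m≤n⊓o⇒m≤n b μ lo≤ , ℕ.m≤n⊓o⇒m≤o b μ lo≤) ℕ.⊓-glb)
                 (⌊⌋-∧ (b ℕ.≤? hi) (M ℕ.≤? hi) (b ⊔ M ℕ.≤? hi)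
                       (λ ≤hi → ℕ.m⊔n≤o⇒m≤o b M ≤hi , ℕ.m⊔n≤o⇒n≤o b M ≤hi) ℕ.⊔-lub) ⟨
  ⌊ lo ℕ.≤? b ⊓ μ ⌋ ∧ ⌊ b ⊔ M ℕ.≤? hi ⌋
    ∎
  where
  open ≡-Reasoning
  μ = smallestPart ((c , f) ∷ ys)
  M = largestPart ((c , f) ∷ ys)

smallestPart-≤-head : ∀ b o ys → smallestPart ((b , o) ∷ ys) ℕ.≤ b
smallestPart-≤-head b o []      = ℕ.≤-refl
smallestPart-≤-head b o (y ∷ _) = ℕ.m⊓n≤m b _

smallestPart-positive : ∀ b o ys → allPositive ((b , o) ∷ ys) ≡ true → 1 ℕ.≤ smallestPart ((b , o) ∷ ys)
smallestPart-positive b o ys pos with 1 ℕ.≤? b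
smallestPart-positive b o []             pos | yes 1≤b = 1≤b
smallestPart-positive b o ((c , f) ∷ ys) pos | yes 1≤b = ℕ.⊓-glb 1≤b (smallestPart-positive c f ys pos)
smallestPart-positive b o ys             () | no _

-- Only l = μ - 1 contributes: below it both indicators agree, above it both vanish.
∑-threshold : ∀ n μ (U : ℕ → Bool) → 1 ℕ.≤ μ → μ ℕ.≤ n →
  ∑ n (λ l → 𝟙 (⌊ suc l ℕ.≤? μ ⌋ ∧ U l) - 𝟙 (⌊ suc (suc l) ℕ.≤? μ ⌋ ∧ U l)) ≡ 𝟙 (U (ℕ.pred μ))
∑-threshold n (suc μ) U _ μ<n = trans (∑-single n μ _ μ<n others) at-threshold
  where
  others : ∀ l → l ℕ.< n → l ≢ μ → 𝟙 (⌊ suc l ℕ.≤? suc μ ⌋ ∧ U l) - 𝟙 (⌊ suc (suc l) ℕ.≤? suc μ ⌋ ∧ U l) ≡ + 0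
  others l _ l≢μ with ℕ.<-cmp l μ
  ... | tri< l<μ _ _ rewrite ⌊⌋-true (suc l ℕ.≤? suc μ) (ℕ.<⇒≤ (s≤s l<μ)) | ⌊⌋-true (suc (suc l) ℕ.≤? suc μ) (s≤s l<μ) =
    ℤ.+-inverseʳ (𝟙 (U l))
  ... | tri≈ _ l≡μ _ = ⊥-elim (l≢μ l≡μ)
  ... | tri> _ _ μ<l rewrite ⌊⌋-false (suc l ℕ.≤? suc μ) (ℕ.<⇒≱ (s≤s μ<l))
                           | ⌊⌋-false (suc (suc l) ℕ.≤? suc μ) (ℕ.<⇒≱ (ℕ.<-trans (s≤s μ<l) (ℕ.n<1+n _))) =
    refl
  at-threshold : 𝟙 (⌊ suc μ ℕ.≤? suc μ ⌋ ∧ U μ) - 𝟙 (⌊ suc (suc μ) ℕ.≤? suc μ ⌋ ∧ U μ) ≡ 𝟙 (U μ)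
  at-threshold rewrite ⌊⌋-true (suc μ ℕ.≤? suc μ) ℕ.≤-refl | ⌊⌋-false (suc (suc μ) ℕ.≤? suc μ) (ℕ.<-irrefl refl) =
    ℤ.+-identityʳ (𝟙 (U μ))

∧-true-left : ∀ {x y} → x ∧ y ≡ true → x ≡ true
∧-true-left {true} _ = refl

∧-true-right : ∀ {x y} → x ∧ y ≡ true → y ≡ true
∧-true-right {true} eq = eq

≤?-+-∸ : ∀ M k t → ⌊ M ℕ.≤? k ℕ.+ t ⌋ ≡ ⌊ M ∸ k ℕ.≤? t ⌋
≤?-+-∸ M k t = ⌊⌋-cong (M ℕ.≤? k ℕ.+ t) (M ∸ k ℕ.≤? t) (ℕ.m≤n+o⇒m∸n≤o M k)
                       (λ M∸k≤t → ℕ.≤-trans (ℕ.m≤n+m∸n M k) (ℕ.+-monoʳ-≤ k M∸k≤t))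

windows-by-smallest-part : ∀ t n b o ys → isOverpartitionOf (suc n) ((b , o) ∷ ys) ≡ true →
  ∑ (suc n) (λ l → 𝟙 (partsWithin (suc l) (l ℕ.+ suc t) ((b , o) ∷ ys)) - 𝟙 (partsWithin (suc (suc l)) (suc l ℕ.+ t) ((b , o) ∷ ys)))
    ≡ 𝟙 (spreadAtMost t ((b , o) ∷ ys))
windows-by-smallest-part t n b o ys isOP = begin
  ∑ (suc n) (λ l → 𝟙 (partsWithin (suc l) (l ℕ.+ suc t) xs) - 𝟙 (partsWithin (suc (suc l)) (suc l ℕ.+ t) xs))
    ≡⟨ ∑-cong (suc n) (λ l → cong₂ (λ u v → 𝟙 u - 𝟙 v)
         (trans (partsWithin-bounds (suc l) (l ℕ.+ suc t) b o ys) (cong (λ h → ⌊ suc l ℕ.≤? μ ⌋ ∧ ⌊ M ℕ.≤? h ⌋) (ℕ.+-suc l t)))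
         (partsWithin-bounds (suc (suc l)) (suc l ℕ.+ t) b o ys)) ⟩
  ∑ (suc n) (λ l → 𝟙 (⌊ suc l ℕ.≤? μ ⌋ ∧ U l) - 𝟙 (⌊ suc (suc l) ℕ.≤? μ ⌋ ∧ U l))
    ≡⟨ ∑-threshold (suc n) μ U 1≤μ μ≤1+n ⟩
  𝟙 (U (ℕ.pred μ))
    ≡⟨ cong 𝟙 (trans (cong (λ k → ⌊ M ℕ.≤? k ℕ.+ t ⌋) (ℕ.suc-pred μ {{ℕ.>-nonZero 1≤μ}})) (≤?-+-∸ M μ t)) ⟩
  𝟙 (spreadAtMost t xs)
    ∎
  where
  open ≡-Reasoning
  xs = (b , o) ∷ ys
  μ = smallestPart xs
  M = largestPart xs
  U : ℕ → Bool
  U l = ⌊ M ℕ.≤? suc l ℕ.+ t ⌋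
  1≤μ : 1 ℕ.≤ μ
  1≤μ = smallestPart-positive b o ys (∧-true-left {allPositive xs} isOP)
  sums : ⌊ b ℕ.+ partSum ys ℕ.≟ suc n ⌋ ≡ true
  sums = ∧-true-right {sorted xs} (∧-true-right {allPositive xs} isOP)
  μ≤1+n : μ ℕ.≤ suc n
  μ≤1+n = ℕ.≤-trans (smallestPart-≤-head b o ys)
    (subst (b ℕ.≤_) (toWitness {a? = b ℕ.+ partSum ys ℕ.≟ suc n} (subst T (sym sums) tt)) (ℕ.m≤m+n b (partSum ys)))

fitsWindow : ℕ → ℕ → ℕ → List Entry → Bool
fitsWindow l c = PartsAbove.fits l (PartsAbove.inWindow l c)

indicator-by-smallest-part : ∀ t n xs →
  𝟙 (isOverpartitionOf (suc n) xs ∧ spreadAtMost t xs)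
    ≡ ∑ (suc n) (λ l → 𝟙 (fitsWindow l (suc t) (suc n) xs) - 𝟙 (fitsWindow (suc l) t (suc n) xs))
indicator-by-smallest-part t n xs = trans (by-cases xs (isOverpartitionOf N xs) refl)
  (sym (∑-cong N (λ l → cong₂ (λ u v → 𝟙 u - 𝟙 v)
         (PartsAbove.fits-inWindow l (suc t) N xs) (PartsAbove.fits-inWindow (suc l) t N xs))))
  where
  N = suc n
  D : ℕ → List Entry → ℤ
  D l xs = 𝟙 (isOverpartitionOf N xs ∧ partsWithin (suc l) (l ℕ.+ suc t) xs)
         - 𝟙 (isOverpartitionOf N xs ∧ partsWithin (suc (suc l)) (suc l ℕ.+ t) xs)
  by-cases : ∀ xs v → isOverpartitionOf N xs ≡ v → 𝟙 (isOverpartitionOf N xs ∧ spreadAtMost t xs) ≡ ∑ N (λ l → D l xs)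
  by-cases xs             false eq rewrite eq = sym (∑-zero N (λ _ _ → refl))
  by-cases ((b , o) ∷ ys) true  eq rewrite eq = sym (windows-by-smallest-part t n b o ys eq)

sumℤ-map-∑ : ∀ {A : Set} n (g : ℕ → A → ℤ) xs → sumℤ (map (λ x → ∑ n (λ l → g l x)) xs) ≡ ∑ n (λ l → sumℤ (map (g l) xs))
sumℤ-map-∑ n g []       = sym (∑-zero n (λ _ _ → refl))
sumℤ-map-∑ n g (x ∷ xs) = trans (cong (_+_ (∑ n (λ l → g l x))) (sumℤ-map-∑ n g xs))
                                (sym (∑-+ n (λ l → g l x) (λ l → sumℤ (map (g l) xs))))

sumℤ-map-- : ∀ {A : Set} (f g : A → ℤ) xs → sumℤ (map (λ x → f x - g x) xs) ≡ sumℤ (map f xs) - sumℤ (map g xs)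
sumℤ-map-- f g []       = refl
sumℤ-map-- f g (x ∷ xs) = trans (cong (_+_ (f x - g x)) (sumℤ-map-- f g xs)) (regroup (f x) (g x) _ _)
  where
  regroup : ∀ a b c d → a - b + (c - d) ≡ a + c - (b + d)
  regroup = solve-∀

count-fitsWindow : ∀ l c n → count (fitsWindow l c n) (candidates n) ≡ window l c n
count-fitsWindow l c n = begin
  count (fitsWindow l c n) (candidates n)                                        ≡⟨ count-candidates (fitsWindow l c n) n ⟩
  ∑ (suc n) (λ k → count (fitsWindow l c n) (wordsOfLength k (entries n)))       ≡⟨ PartsAbove.count-fits l n n _ n ℕ.≤-refl ⟩
  PartsAbove.fitSeries l (PartsAbove.inWindow l c) n                                ≡⟨ PartsAbove.fitSeries-inWindow l c .coeff n ⟩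
  window l c n                                                                      ∎
  where open ≡-Reasoning

lhs≡windowSum : ∀ t m → lhs t m ≡ windowSum t m
lhs≡windowSum t zero    = refl
lhs≡windowSum t (suc n) = begin
  + pbar t N
    ≡⟨ count-filter (λ xs → T? (isOverpartitionOf N xs ∧ spreadAtMost t xs)) (candidates N) ⟩
  sumℤ (map (λ xs → 𝟙 (isOverpartitionOf N xs ∧ spreadAtMost t xs)) (candidates N))
    ≡⟨ cong sumℤ (List.map-cong (indicator-by-smallest-part t n) (candidates N)) ⟩
  sumℤ (map (λ xs → ∑ N (λ l → D l xs)) (candidates N))
    ≡⟨ sumℤ-map-∑ N D (candidates N) ⟩
  ∑ N (λ l → sumℤ (map (D l) (candidates N)))
    ≡⟨ ∑-cong N (λ l → trans (sumℤ-map-- (𝟙 ∘ fitsWindow l (suc t) N) (𝟙 ∘ fitsWindow (suc l) t N) (candidates N))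
                             (cong₂ _-_ (count-fitsWindow l (suc t) N) (count-fitsWindow (suc l) t N))) ⟩
  windowSum t N
    ∎
  where
  open ≡-Reasoning
  N = suc n
  D : ℕ → List Entry → ℤ
  D l xs = 𝟙 (fitsWindow l (suc t) N xs) - 𝟙 (fitsWindow (suc l) t N xs)

theorem2 : (t m : ℕ) → lhs t m ≡ rhs t m
theorem2 t m = trans (lhs≡windowSum t m) (windowSum≡rhs t m)
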